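{- Let $\sigma=k=2$, $\Sigma=\{0,1\}$. (1) For every integer $w\ge2$, the minimum density of a minimizer with parameters $(2,2,w)$ is $\frac{2^w+w+5}{2^{w+2}}$. (2) The order $\rho=(01,10,00,11)$ is optimal for all $w\ge2$ and essentially unique.
   Context: A $k$-mer is a string of length $k$ over $\Sigma=\{0,\dots,\sigma-1\}$; $s$ avoids $t$ if $t$ is not a substring of $s$. An arrangement of $\Sigma^k$ is a sequence $\rho$ of distinct $k$-mers ($\rho[j]$ has rank $j$); its domain is the set of entries; a linear order is an arrangement of all of $\Sigma^k$. The domain $U$ is a universal hitting set (UHS) for $w$ if every string of length $w+k-1$ contains a $k$-mer of $U$; $\mathbb{U}_{\sigma,k}$ is the set of arrangements whose domain is a UHS for some $w$. For $\rho$ whose domain is a UHS for $w$, the minimizer $(\rho,w)$ selects, in each length-$(w+k-1)$ window of a string $S$, the starting position of the leftmost occurrence of the minimum-rank domain $k$-mer occurring in the window; its density $d_{(\rho,w)}=\lim_{n\to\infty}\sigma^{ -n}\sum_{S\in\Sigma^n}|f(S)|/n$, $f(S)$ the set of selected positions (equivalently, the fraction of strings $v\in\Sigma^{w+k}$ whose minimum-rank $k$-mer is its length-$k$ prefix or its length-$k$ suffix occurring only once in $v$). The minimizers with parameters $(\sigma,k,w)$ are $(\tau,w)$ for linear orders $\tau$. $\rho\in\mathbb{U}_{\sigma,k}$ is optimal for $w$ if its domain is a UHS for $w$ and $(\rho,w)$ has the minimum density among all minimizers with parameters $(\sigma,k,w)$; it is eventually optimal if it is optimal for infinitely many $w$.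 Let $\mathcal{L}_{\rho,j}$ be the set of strings avoiding $\rho[1],\dots,\rho[j]$ ($\mathcal{L}_{\rho,0}=\Sigma^*$) and $\alpha_{\rho,j}=\limsup_n|\mathcal{L}_{\rho,j}\cap\Sigma^n|^{1/n}$. The head of $\rho\in\mathbb{U}_{\sigma,k}$ is $\rho[1..i]$ where $i$ is such that $\alpha_{\rho,i-1}>\alpha_{\rho,i}=1$. A head $\pi=\rho[1..i]$ is good if $\alpha_{\pi,j-1}>\alpha_{\pi,j}$ for all $j\in[1..i]$. Renaming letters means applying a permutation $h$ of $\Sigma$ letterwise to every $k$-mer. An eventually optimal $\rho\in\mathbb{U}_{\sigma,k}$ is essentially unique if its head $\pi$ is, up to renaming letters, the unique good head of an eventually optimal order in $\mathbb{U}_{\sigma,k}$ (i.e. $\pi$ is good and every eventually optimal element of $\mathbb{U}_{\sigma,k}$ with a good head has head $h(\pi)$ for some permutation $h$ of $\Sigma$). -}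

module Defs where

open import Data.Nat using (ℕ; zero; suc; _+_; _*_; _∸_; _^_; _≤_; _<_; NonZero)
open import Data.Nat.Properties using (m^n≢0)
open import Data.Fin using (Fin)
open import Data.Fin.Permutation using (Permutation′; _⟨$⟩ʳ_)
open import Data.List using (List; []; _∷_; _++_; length; filter; map; concatMap; take; drop; allFin; head)
open import Data.List.Membership.Propositional using (_∈_)
open import Data.List.Relation.Unary.Unique.Propositional using (Unique)
open import Data.List.Relation.Unary.Any using (any?)
open import Data.Vec as Vec using (Vec)
import Data.Vec.Properties as VecP
open import Data.Maybe as Maybe using (Maybe; just; nothing; maybe)
import Data.Maybe.Properties as MaybeP
import Data.Fin.Properties as FinP
open import Data.Product using (Σ; ∃; ∃-syntax; _×_; _,_)
open import Data.Sum using (_⊎_)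
open import Data.Integer using (+_)
open import Data.Rational using (ℚ; _/_)
open import Relation.Nullary using (¬_; Dec)
open import Relation.Nullary.Decidable using (_⊎-dec_; _×-dec_; ¬?)
open import Relation.Binary.PropositionalEquality using (_≡_)
import Data.Nat.Properties as ℕP

KMer : ℕ → ℕ → Set
KMer σ k = Vec (Fin σ) k

_≟K_ : ∀ {σ k} (s t : KMer σ k) → Dec (s ≡ t)
_≟K_ = VecP.≡-dec FinP._≟_

takeVec : ∀ {A : Set} k → List A → Maybe (Vec A k)
takeVec zero _ = just Vec.[]
takeVec (suc k) [] = nothing
takeVec (suc k) (x ∷ xs) = Maybe.map (x Vec.∷_) (takeVec k xs)

maybeToList : ∀ {A : Set} → Maybe A → List A
maybeToList nothing = []
maybeToList (just x) = x ∷ []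

windows : ∀ {A : Set} k → List A → List (Vec A k)
windows k [] = maybeToList (takeVec k [])
windows k (x ∷ xs) = maybeToList (takeVec k (x ∷ xs)) ++ windows k xs

Occurs : ∀ {σ k} → KMer σ k → List (Fin σ) → Set
Occurs {k = k} t s = t ∈ windows k s

occurs? : ∀ {σ k} (t : KMer σ k) (s : List (Fin σ)) → Dec (Occurs t s)
occurs? t s = any? (t ≟K_) _

Avoids : ∀ {σ k} → List (Fin σ) → KMer σ k → Set
Avoids s t = ¬ Occurs t s

occCount : ∀ {σ k} → KMer σ k → List (Fin σ) → ℕ
occCount {k = k} t s = length (filter (t ≟K_) (windows k s))

allWords : ∀ σ → ℕ → List (List (Fin σ))
allWords σ zero = [] ∷ []
allWords σ (suc n) = concatMap (λ a → map (a ∷_) (allWords σ n)) (allFin σ)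

-- Arrangements (ρ[j] has rank j; list position 0 = rank 1)

Arrangement : ℕ → ℕ → Set
Arrangement σ k = List (KMer σ k)

IsArrangement : ∀ {σ k} → Arrangement σ k → Set
IsArrangement ρ = Unique ρ

IsLinearOrder : ∀ {σ k} → Arrangement σ k → Set
IsLinearOrder {σ} {k} ρ = Unique ρ × (∀ (t : KMer σ k) → t ∈ ρ)

IsUHS : ∀ {σ k} → List (KMer σ k) → ℕ → Set
IsUHS {σ} {k} U w =
  ∀ (s : List (Fin σ)) → length s ≡ w + k ∸ 1 → ∃[ t ] (t ∈ U × Occurs t s)

InU : ∀ {σ k} → Arrangement σ k → Set
InU ρ = IsArrangement ρ × ∃[ w ] (1 ≤ w × IsUHS ρ w)

minKmer : ∀ {σ k} → Arrangement σ k → List (Fin σ) → Maybe (KMer σ k)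
minKmer ρ v = head (filter (λ t → occurs? t v) ρ)

prefixK : ∀ {σ} k → List (Fin σ) → Maybe (KMer σ k)
prefixK k v = takeVec k v

suffixK : ∀ {σ} k → List (Fin σ) → Maybe (KMer σ k)
suffixK k v = takeVec k (drop (length v ∸ k) v)

Charged : ∀ {σ k} → Arrangement σ k → List (Fin σ) → Set
Charged {k = k} ρ v =
  (minKmer ρ v ≡ prefixK k v)
  ⊎ (minKmer ρ v ≡ suffixK k v × maybe (λ t → occCount t v) 0 (suffixK k v) ≡ 1)

charged? : ∀ {σ k} (ρ : Arrangement σ k) (v : List (Fin σ)) → Dec (Charged ρ v)
charged? {k = k} ρ v =
  MaybeP.≡-dec _≟K_ (minKmer ρ v) (prefixK k v)
  ⊎-dec (MaybeP.≡-dec _≟K_ (minKmer ρ v) (suffixK k v)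
         ×-dec (maybe (λ t → occCount t v) 0 (suffixK k v) ℕP.≟ 1))

chargedCount : ∀ {σ k} → Arrangement σ k → ℕ → ℕ
chargedCount {σ} {k} ρ w = length (filter (charged? ρ) (allWords σ (w + k)))

fracPow : ℕ → (σ e : ℕ) .{{_ : NonZero σ}} → ℚ
fracPow n σ e = _/_ (+ n) (σ ^ e) {{m^n≢0 σ e}}

density : ∀ {σ k} .{{_ : NonZero σ}} → Arrangement σ k → ℕ → ℚ
density {σ} {k} ρ w = fracPow (chargedCount ρ w) σ (w + k)

Optimal : ∀ {σ k} .{{_ : NonZero σ}} → Arrangement σ k → ℕ → Set
Optimal {σ} {k} ρ w =
  InU ρ × IsUHS ρ w
  × (∀ (τ : Arrangement σ k) → IsLinearOrder τ → density ρ w Data.Rational.≤ density τ w)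

EventuallyOptimal : ∀ {σ k} .{{_ : NonZero σ}} → Arrangement σ k → Set
EventuallyOptimal ρ = InU ρ × (∀ N → ∃[ w ] (N ≤ w × Optimal ρ w))

-- Growth rates α = limsup_n c(n)^{1/n}, compared against rationals a/b

avoidCount : ∀ {σ k} → Arrangement σ k → ℕ → ℕ → ℕ
avoidCount {σ} ρ j n =
  length (filter (λ s → ¬? (any? (λ t → occurs? t s) (take j ρ))) (allWords σ n))

-- limsup c(n)^{1/n} ≤ a/b   (b > 0): eventually c(n)·bⁿ ≤ aⁿ
EventuallyBelow : (ℕ → ℕ) → ℕ → ℕ → Set
EventuallyBelow c a b = ∃[ N ] (∀ n → N ≤ n → c n * b ^ n ≤ a ^ n)

-- infinitely often c(n)^{1/n} ≥ a/b
InfOftenAbove : (ℕ → ℕ) → ℕ → ℕ → Set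
InfOftenAbove c a b = ∀ N → ∃[ n ] (N ≤ n × a ^ n ≤ c n * b ^ n)

-- limsup c₁(n)^{1/n} > limsup c₂(n)^{1/n}
-- (there are rationals a/b < c/d with α(c₂) ≤ a/b and c/d ≤ α(c₁))
GrowthGt : (ℕ → ℕ) → (ℕ → ℕ) → Set
GrowthGt c₁ c₂ = ∃[ a ] ∃[ b ] ∃[ c ] ∃[ d ]
  (0 < b × 0 < d × a * d < c * b × EventuallyBelow c₂ a b × InfOftenAbove c₁ c d)

-- limsup c(n)^{1/n} = 1
GrowthOne : (ℕ → ℕ) → Set
GrowthOne c =
  (∀ a b → 0 < b → b < a → EventuallyBelow c a b)
  × (∀ a b → 0 < b → a < b → InfOftenAbove c a b)

AlphaDrops : ∀ {σ k} → Arrangement σ k → ℕ → Set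
AlphaDrops ρ j = GrowthGt (avoidCount ρ (j ∸ 1)) (avoidCount ρ j)

IsHead : ∀ {σ k} → Arrangement σ k → Arrangement σ k → Set
IsHead ρ π = ∃[ i ] (1 ≤ i × i ≤ length ρ × AlphaDrops ρ i
                     × GrowthOne (avoidCount ρ i) × π ≡ take i ρ)

GoodHead : ∀ {σ k} → Arrangement σ k → Set
GoodHead π = ∀ j → 1 ≤ j → j ≤ length π → AlphaDrops π j

rename : ∀ {σ k} → Permutation′ σ → Arrangement σ k → Arrangement σ k
rename h π = map (Vec.map (h ⟨$⟩ʳ_)) π

EssentiallyUnique : ∀ {σ k} .{{_ : NonZero σ}} → Arrangement σ k → Set
EssentiallyUnique {σ} {k} ρ =
  EventuallyOptimal ρ
  × ∃[ π ] (IsHead ρ π × GoodHead π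
      × (∀ (ρ′ π′ : Arrangement σ k) → EventuallyOptimal ρ′ → IsHead ρ′ π′ → GoodHead π′
           → ∃[ h ] (π′ ≡ rename h π)))

{-# OPTIONS --safe #-}
-- Whether a word is charged depends only on a finite summary of it: its first two letters, its
-- last dimer, and how often each dimer occurs, counted up to 2; runs of one letter longer than 3
-- do not change the summary. So infinite families of words can be shown charged (or not) by
-- finitely many evaluations.
-- If a linear order ranks xy first (x ≠ y), the charged contexts of length w + 2 include the 2^w
-- words starting with xy, the w + 1 words y^a x^(b+1) y with a + b = w, and four words y^a x^b:
-- at least 2^w + w + 5, with equality for ρ₀ = (01, 10, 00, 11). If it ranks xx first, they
-- include the 2^w words starting with xx and the Fibonacci many words u y x x with u avoiding xx,
-- which is strictly more for w ≥ 6; smaller widths are checked by evaluation.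
-- Hence an eventually optimal order starts with some xy, x ≠ y. The strings avoiding xy are the
-- y^a x^b, linearly many, so the growth rate reaches 1 after the first entry already and the head
-- is (xy), a renaming of (01).
module Submission where

open import Defs
open import Data.Nat using (ℕ; _+_; _^_; _≤_)
open import Data.Fin using (Fin; zero; suc)
open import Data.Vec using (_∷_; [])
open import Data.List using (List; []; _∷_)
open import Data.Product using (_×_; ∃-syntax)
open import Data.Rational using (ℚ)
open import Relation.Binary.PropositionalEquality using (_≡_)

open import Data.Bool using (Bool; true; false)
open import Data.Empty using (⊥; ⊥-elim)
open import Data.Fin using (_≟_)
import Data.Fin.Permutation as Perm
import Data.Integer as ℤ
import Data.Integer.Properties as ℤ
open import Algebra.Properties.CommutativeSemigroup ℤ.*-commutativeSemigroup using (interchange)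
open import Data.List using (_++_; length; filter; map; replicate; foldr; concatMap; allFin; take; head)
import Data.List.Properties as List
open import Data.List.Membership.Propositional using (_∈_; _∉_; lose)
open import Data.List.Membership.Propositional.Properties
open import Data.List.Relation.Binary.Disjoint.Propositional using (Disjoint)
open import Data.List.Relation.Unary.All as All using (All; []; _∷_)
open import Data.List.Relation.Unary.All.Properties using (¬Any⇒All¬)
open import Data.List.Relation.Unary.AllPairs using ([]; _∷_)
open import Data.List.Relation.Unary.Any as Any using (here; there; any?)
open import Data.List.Relation.Unary.Unique.DecPropositional using (unique?)
open import Data.List.Relation.Unary.Unique.Propositional using (Unique)
import Data.List.Relation.Unary.Unique.Propositional.Properties as Unique
open import Data.Maybe using (Maybe; just; nothing; maybe)
import Data.Maybe.Properties as Maybe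
open import Data.Nat using (zero; suc; _*_; _∸_; _<_; _⊓_; z≤n; s≤s; NonZero; ≢-nonZero; ≢-nonZero⁻¹; >-nonZero; >-nonZero⁻¹)
open import Data.Nat.GCD using (gcd; gcd[m,n]≢0)
import Data.Nat.Properties as ℕ
open import Data.Nat.Tactic.RingSolver using (solve-∀)
open import Data.Product using (∃₂; _,_; proj₁; proj₂)
open import Data.Rational using (_/_; ↥_; ↧_; *≤*) renaming (_≤_ to _≤ℚ_)
import Data.Rational.Properties as ℚ
open import Data.Sum using (_⊎_; inj₁; inj₂)
open import Function using (_∘_; _$_)
open import Relation.Binary.PropositionalEquality using (_≢_; refl; sym; trans; cong; cong₂; subst; module ≡-Reasoning)
open import Relation.Nullary using (¬_; Dec; yes; no)
open import Relation.Nullary.Decidable using (_×-dec_; _⊎-dec_; ¬?; map′; from-yes; from-no)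

Bit : Set
Bit = Fin 2

Word : Set
Word = List Bit

Dimer : Set
Dimer = KMer 2 2

pattern 𝟎 = zero
pattern 𝟏 = suc zero

infix 6 _·_
pattern _·_ x y = x ∷ y ∷ []

other : Bit → Bit
other 𝟎 = 𝟏
other 𝟏 = 𝟎

other-≢ : ∀ x → other x ≢ x
other-≢ 𝟎 ()
other-≢ 𝟏 ()

StartsWith : Bit → Bit → Word → Set
StartsWith x y v = ∃[ u ] (v ≡ x ∷ y ∷ u)

-- Summaries of words

data Count : Set where
  none once many : Count

bump : Count → Count
bump none = once
bump once = many
bump many = many

cap : ℕ → Count
cap 0 = none
cap 1 = once
cap (suc (suc _)) = many

cap-suc : ∀ n → cap (suc n) ≡ bump (cap n)
cap-suc 0 = refl
cap-suc 1 = refl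
cap-suc (suc (suc n)) = refl

-- Everything `Charged` looks at, with occurrence counts needed only up to 2.
record Summary : Set where
  constructor summary
  field
    first second : Maybe Bit
    lastPair : Maybe Dimer
    count₀₀ count₀₁ count₁₀ count₁₁ : Count
open Summary

countOf : Summary → Dimer → Count
countOf s (𝟎 · 𝟎) = count₀₀ s
countOf s (𝟎 · 𝟏) = count₀₁ s
countOf s (𝟏 · 𝟎) = count₁₀ s
countOf s (𝟏 · 𝟏) = count₁₁ s

countAfter : Bit → Maybe Bit → Dimer → Count → Count
countAfter a nothing t c = c
countAfter a (just b) t c with t ≟K (a · b)
... | yes _ = bump c
... | no _ = c

lastPairAfter : Bit → Maybe Bit → Maybe Bit → Maybe Dimer → Maybe Dimer
lastPairAfter a (just b) nothing _ = just (a · b)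
lastPairAfter a _ _ p = p

infixr 5 _◁_
_◁_ : Bit → Summary → Summary
a ◁ s = summary (just a) (first s) (lastPairAfter a (first s) (second s) (lastPair s))
  (countAfter a (first s) (𝟎 · 𝟎) (count₀₀ s)) (countAfter a (first s) (𝟎 · 𝟏) (count₀₁ s))
  (countAfter a (first s) (𝟏 · 𝟎) (count₁₀ s)) (countAfter a (first s) (𝟏 · 𝟏) (count₁₁ s))

emptySummary : Summary
emptySummary = summary nothing nothing nothing none none none none

summarize : Word → Summary
summarize = foldr _◁_ emptySummary

countOf-empty : ∀ t → countOf emptySummary t ≡ none
countOf-empty (𝟎 · 𝟎) = refl
countOf-empty (𝟎 · 𝟏) = refl
countOf-empty (𝟏 · 𝟎) = refl
countOf-empty (𝟏 · 𝟏) = refl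

countOf-◁ : ∀ a s t → countOf (a ◁ s) t ≡ countAfter a (first s) t (countOf s t)
countOf-◁ a s (𝟎 · 𝟎) = refl
countOf-◁ a s (𝟎 · 𝟏) = refl
countOf-◁ a s (𝟏 · 𝟎) = refl
countOf-◁ a s (𝟏 · 𝟏) = refl

countOf-summarize : ∀ t v → countOf (summarize v) t ≡ cap (occCount t v)
countOf-summarize t [] = countOf-empty t
countOf-summarize t (a ∷ []) = trans (countOf-◁ a emptySummary t) (countOf-empty t)
countOf-summarize t (a ∷ b ∷ v) = begin
  countOf (a ◁ summarize (b ∷ v)) t                ≡⟨ countOf-◁ a (summarize (b ∷ v)) t ⟩
  countAfter a (just b) t (countOf (summarize (b ∷ v)) t) ≡⟨ cong (countAfter a (just b) t) (countOf-summarize t (b ∷ v)) ⟩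
  countAfter a (just b) t (cap (occCount t (b ∷ v))) ≡⟨ step ⟩
  cap (occCount t (a ∷ b ∷ v))                     ∎
  where
  open ≡-Reasoning
  step : countAfter a (just b) t (cap (occCount t (b ∷ v))) ≡ cap (occCount t (a ∷ b ∷ v))
  step with t ≟K (a · b)
  ... | yes _ = sym (cap-suc _)
  ... | no _ = refl

cap-none : ∀ {n} → cap n ≡ none → n ≡ 0
cap-none {0} _ = refl
cap-none {1} ()
cap-none {suc (suc _)} ()

cap-once : ∀ {n} → cap n ≡ once → n ≡ 1
cap-once {1} _ = refl
cap-once {0} ()
cap-once {suc (suc _)} ()

_≟C_ : (c d : Count) → Dec (c ≡ d)
none ≟C none = yes refl
once ≟C once = yes refl
many ≟C many = yes refl
none ≟C once = no λ ()
none ≟C many = no λ ()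
once ≟C none = no λ ()
once ≟C many = no λ ()
many ≟C none = no λ ()
many ≟C once = no λ ()

Occurs⇒count≢none : ∀ {t} v → Occurs t v → countOf (summarize v) t ≢ none
Occurs⇒count≢none {t} v occ eq =
  ℕ.<⇒≢ (List.filter-some (t ≟K_) occ) (sym (cap-none (trans (sym (countOf-summarize t v)) eq)))

count≢none⇒Occurs : ∀ {t} v → countOf (summarize v) t ≢ none → Occurs t v
count≢none⇒Occurs {t} v ne with occurs? t v
... | yes occ = occ
... | no ¬occ = ⊥-elim (ne (trans (countOf-summarize t v)
        (cong (cap ∘ length) (List.filter-none (t ≟K_) (¬Any⇒All¬ _ ¬occ)))))

minKmerOf : Arrangement 2 2 → Summary → Maybe Dimer
minKmerOf ρ s = head (filter (λ t → ¬? (countOf s t ≟C none)) ρ)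

minKmer-summarize : ∀ ρ v → minKmer ρ v ≡ minKmerOf ρ (summarize v)
minKmer-summarize ρ v = cong head $
  List.filter-≐ (λ t → occurs? t v) (λ t → ¬? (countOf (summarize v) t ≟C none))
    (Occurs⇒count≢none v , count≢none⇒Occurs v) ρ

prefixOf : Summary → Maybe Dimer
prefixOf s with first s | second s
... | just a | just b = just (a · b)
... | _ | _ = nothing

prefixK-summarize : ∀ v → prefixK 2 v ≡ prefixOf (summarize v)
prefixK-summarize [] = refl
prefixK-summarize (a ∷ []) = refl
prefixK-summarize (a ∷ b ∷ v) = refl

suffixK-summarize : ∀ v → suffixK 2 v ≡ lastPair (summarize v)
suffixK-summarize [] = refl
suffixK-summarize (a ∷ []) = refl
suffixK-summarize (a ∷ b ∷ []) = refl
suffixK-summarize (a ∷ b ∷ c ∷ v) = suffixK-summarize (b ∷ c ∷ v)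

prefixOf-summarize⁻ : ∀ v {x y} → prefixOf (summarize v) ≡ just (x · y) → StartsWith x y v
prefixOf-summarize⁻ (a ∷ b ∷ u) refl = u , refl

lastPairCount : Summary → Count
lastPairCount s = maybe (countOf s) none (lastPair s)

lastPairCount-summarize : ∀ v → lastPairCount (summarize v) ≡ cap (maybe (λ t → occCount t v) 0 (suffixK 2 v))
lastPairCount-summarize v rewrite suffixK-summarize v with lastPair (summarize v)
... | nothing = refl
... | just t = countOf-summarize t v

ChargedSummary : Arrangement 2 2 → Summary → Set
ChargedSummary ρ s = minKmerOf ρ s ≡ prefixOf s ⊎ (minKmerOf ρ s ≡ lastPair s × lastPairCount s ≡ once)

chargedSummary? : ∀ ρ s → Dec (ChargedSummary ρ s)
chargedSummary? ρ s = (minKmerOf ρ s ≟M prefixOf s) ⊎-dec ((minKmerOf ρ s ≟M lastPair s) ×-dec (lastPairCount s ≟C once))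
  where _≟M_ = Maybe.≡-dec _≟K_

Charged⇒ChargedSummary : ∀ ρ v → Charged ρ v → ChargedSummary ρ (summarize v)
Charged⇒ChargedSummary ρ v (inj₁ e) = inj₁ (trans (sym (minKmer-summarize ρ v)) (trans e (prefixK-summarize v)))
Charged⇒ChargedSummary ρ v (inj₂ (e , c)) =
  inj₂ (trans (sym (minKmer-summarize ρ v)) (trans e (suffixK-summarize v)) , trans (lastPairCount-summarize v) (cong cap c))

ChargedSummary⇒Charged : ∀ ρ v → ChargedSummary ρ (summarize v) → Charged ρ v
ChargedSummary⇒Charged ρ v (inj₁ e) = inj₁ (trans (minKmer-summarize ρ v) (trans e (sym (prefixK-summarize v))))
ChargedSummary⇒Charged ρ v (inj₂ (e , c)) =
  inj₂ (trans (minKmer-summarize ρ v) (trans e (sym (suffixK-summarize v))) ,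
        cap-once (trans (sym (lastPairCount-summarize v)) c))

bump≢none : ∀ c → bump c ≢ none
bump≢none none ()
bump≢none once ()
bump≢none many ()

countAfter-≢none : ∀ a mb t {c} → c ≢ none → countAfter a mb t c ≢ none
countAfter-≢none a nothing t c≢none = c≢none
countAfter-≢none a (just b) t c≢none with t ≟K (a · b)
... | yes _ = bump≢none _
... | no _ = c≢none

count-◁◁≢none : ∀ x y s → countOf (x ◁ y ◁ s) (x · y) ≢ none
count-◁◁≢none 𝟎 𝟎 s = bump≢none _
count-◁◁≢none 𝟎 𝟏 s = bump≢none _
count-◁◁≢none 𝟏 𝟎 s = bump≢none _
count-◁◁≢none 𝟏 𝟏 s = bump≢none _

lastPair-count≢none : ∀ v {t} → lastPair (summarize v) ≡ just t → countOf (summarize v) t ≢ none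
lastPair-count≢none (a ∷ b ∷ []) refl = count-◁◁≢none a b emptySummary
lastPair-count≢none (a ∷ b ∷ c ∷ v) {t} last≡t e =
  countAfter-≢none a (just b) t (lastPair-count≢none (b ∷ c ∷ v) last≡t) (trans (sym (countOf-◁ a _ t)) e)

bump-idem : ∀ c → bump (bump (bump c)) ≡ bump (bump c)
bump-idem none = refl
bump-idem once = refl
bump-idem many = refl

◁-absorbs : ∀ y s → y ◁ y ◁ y ◁ y ◁ s ≡ y ◁ y ◁ y ◁ s
◁-absorbs 𝟎 s = cong (λ c → record (𝟎 ◁ 𝟎 ◁ 𝟎 ◁ s) { count₀₀ = c }) (bump-idem _)
◁-absorbs 𝟏 s = cong (λ c → record (𝟏 ◁ 𝟏 ◁ 𝟏 ◁ s) { count₁₁ = c }) (bump-idem _)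

summarize-++ : ∀ u {r r′} → summarize r ≡ summarize r′ → summarize (u ++ r) ≡ summarize (u ++ r′)
summarize-++ u {r} {r′} e = begin
  summarize (u ++ r)              ≡⟨ List.foldr-++ _◁_ emptySummary u r ⟩
  foldr _◁_ (summarize r) u       ≡⟨ cong (λ s → foldr _◁_ s u) e ⟩
  foldr _◁_ (summarize r′) u      ≡⟨ List.foldr-++ _◁_ emptySummary u r′ ⟨
  summarize (u ++ r′)             ∎
  where open ≡-Reasoning

summarize-replicate : ∀ n y r → summarize (replicate n y ++ r) ≡ summarize (replicate (3 ⊓ n) y ++ r)
summarize-replicate 0 y r = refl
summarize-replicate 1 y r = refl
summarize-replicate 2 y r = refl
summarize-replicate 3 y r = refl
summarize-replicate (suc (suc (suc (suc n)))) y r =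
  trans (cong (y ◁_) (summarize-replicate (suc (suc (suc n))) y r)) (◁-absorbs y (summarize r))

runs : Bit → ℕ → Bit → ℕ → Word → Word
runs y a x b r = replicate a y ++ replicate b x ++ r

summarize-runs : ∀ y a x b r → summarize (runs y a x b r) ≡ summarize (runs y (3 ⊓ a) x (3 ⊓ b) r)
summarize-runs y a x b r =
  trans (summarize-replicate a y _) (summarize-++ (replicate (3 ⊓ a) y) (summarize-replicate b x r))

summarize-runs-cap : ∀ y a x b {a′ b′} r → 3 ⊓ a ≡ 3 ⊓ a′ → 3 ⊓ b ≡ 3 ⊓ b′ →
  summarize (runs y a x b r) ≡ summarize (runs y a′ x b′ r)
summarize-runs-cap y a x b {a′} {b′} r a≈a′ b≈b′ = begin
  summarize (runs y a x b r)                    ≡⟨ summarize-runs y a x b r ⟩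
  summarize (runs y (3 ⊓ a) x (3 ⊓ b) r)        ≡⟨ cong₂ (λ m n → summarize (runs y m x n r)) a≈a′ b≈b′ ⟩
  summarize (runs y (3 ⊓ a′) x (3 ⊓ b′) r)      ≡⟨ summarize-runs y a′ x b′ r ⟨
  summarize (runs y a′ x b′ r)                  ∎
  where open ≡-Reasoning

length-runs : ∀ y a x b r → length (runs y a x b r) ≡ a + (b + length r)
length-runs y a x b r = begin
  length (replicate a y ++ replicate b x ++ r)          ≡⟨ List.length-++ (replicate a y) ⟩
  length (replicate a y) + length (replicate b x ++ r)  ≡⟨ cong₂ _+_ (List.length-replicate a) (List.length-++ (replicate b x)) ⟩
  a + (length (replicate b x) + length r)               ≡⟨ cong (λ n → a + (n + length r)) (List.length-replicate b) ⟩
  a + (b + length r)                                    ∎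
  where open ≡-Reasoning

bit-cases : ∀ {x y : Bit} → x ≢ y → ∀ c → c ≡ x ⊎ c ≡ y
bit-cases {𝟎} {𝟎} x≢y _ = ⊥-elim (x≢y refl)
bit-cases {𝟏} {𝟏} x≢y _ = ⊥-elim (x≢y refl)
bit-cases {𝟎} {𝟏} _ 𝟎 = inj₁ refl
bit-cases {𝟎} {𝟏} _ 𝟏 = inj₂ refl
bit-cases {𝟏} {𝟎} _ 𝟎 = inj₂ refl
bit-cases {𝟏} {𝟎} _ 𝟏 = inj₁ refl

Occurs-∷ : ∀ {t : Dimer} c v → Occurs t v → Occurs t (c ∷ v)
Occurs-∷ c v = ∈-++⁺ʳ (maybeToList (takeVec 2 (c ∷ v)))

avoids⇒runs : ∀ {x y} → x ≢ y → ∀ v → Avoids v (x · y) → ∃₂ λ a b → v ≡ runs y a x b []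
avoids⇒runs x≢y [] _ = 0 , 0 , refl
avoids⇒runs x≢y (c ∷ v) avoids with avoids⇒runs x≢y v (λ occ → avoids (Occurs-∷ c v occ)) | bit-cases x≢y c
... | a , b , refl | inj₂ refl = suc a , b , refl
... | 0 , b , refl | inj₁ refl = 0 , suc b , refl
... | suc a , b , refl | inj₁ refl = ⊥-elim (avoids (here refl))

Unique-⊆⇒length≤ : ∀ {A : Set} {xs ys : List A} → Unique xs → (∀ {x} → x ∈ xs → x ∈ ys) → length xs ≤ length ys
Unique-⊆⇒length≤ {xs = []} _ _ = z≤n
Unique-⊆⇒length≤ {xs = x ∷ xs} (x∉xs ∷ xs!) xs⊆ys with ∈-∃++ (xs⊆ys (here refl))
... | us , vs , refl = begin
  suc (length xs)                  ≤⟨ s≤s (Unique-⊆⇒length≤ xs! xs⊆us++vs) ⟩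
  suc (length (us ++ vs))          ≡⟨ cong suc (List.length-++ us) ⟩
  suc (length us + length vs)      ≡⟨ ℕ.+-suc (length us) (length vs) ⟨
  length us + length (x ∷ vs)      ≡⟨ List.length-++ us ⟨
  length (us ++ x ∷ vs)            ∎
  where
  open ℕ.≤-Reasoning
  xs⊆us++vs : ∀ {z} → z ∈ xs → z ∈ us ++ vs
  xs⊆us++vs z∈xs with ∈-++⁻ us (xs⊆ys (there z∈xs))
  ... | inj₁ z∈us = ∈-++⁺ˡ z∈us
  ... | inj₂ (here refl) = ⊥-elim (All.lookup x∉xs z∈xs refl)
  ... | inj₂ (there z∈vs) = ∈-++⁺ʳ us z∈vs

lists : ∀ {A : Set} → List A → ℕ → List (List A)
lists xs zero = [] ∷ []
lists xs (suc n) = concatMap (λ a → map (a ∷_) (lists xs n)) xs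

∈-lists : ∀ {A : Set} {xs ys : List A} → All (_∈ xs) ys → ys ∈ lists xs (length ys)
∈-lists [] = here refl
∈-lists (y∈xs ∷ ys∈xs) = ∈-concatMap⁺ _ (Any.map (λ { refl → ∈-map⁺ _ (∈-lists ys∈xs) }) y∈xs)

allWords-lists : ∀ n → allWords 2 n ≡ lists (allFin 2) n
allWords-lists zero = refl
allWords-lists (suc n) = cong (λ ws → concatMap (λ a → map (a ∷_) ws) (allFin 2)) (allWords-lists n)

∈-allWords : ∀ v → v ∈ allWords 2 (length v)
∈-allWords v = subst (v ∈_) (sym (allWords-lists (length v))) (∈-lists (All.tabulate λ {a} _ → ∈-allFin a))

allWords-suc : ∀ n → allWords 2 (suc n) ≡ map (𝟎 ∷_) (allWords 2 n) ++ map (𝟏 ∷_) (allWords 2 n)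
allWords-suc n = cong (map (𝟎 ∷_) (allWords 2 n) ++_) (List.++-identityʳ _)

∈-allWords⇒length : ∀ {n v} → v ∈ allWords 2 n → length v ≡ n
∈-allWords⇒length {zero} (here refl) = refl
∈-allWords⇒length {suc n} v∈ rewrite allWords-suc n with ∈-++⁻ (map (𝟎 ∷_) (allWords 2 n)) v∈
... | inj₁ v∈₀ with ∈-map⁻ (𝟎 ∷_) v∈₀
...   | u , u∈ , refl = cong suc (∈-allWords⇒length u∈)
∈-allWords⇒length {suc n} v∈ | inj₂ v∈₁ with ∈-map⁻ (𝟏 ∷_) v∈₁
...   | u , u∈ , refl = cong suc (∈-allWords⇒length u∈)

allWords-unique : ∀ n → Unique (allWords 2 n)
allWords-unique zero = [] ∷ []
allWords-unique (suc n) rewrite allWords-suc n =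
  Unique.++⁺ (Unique.map⁺ List.∷-injectiveʳ (allWords-unique n)) (Unique.map⁺ List.∷-injectiveʳ (allWords-unique n)) disjoint
  where
  disjoint : Disjoint (map (𝟎 ∷_) (allWords 2 n)) (map (𝟏 ∷_) (allWords 2 n))
  disjoint (v∈₀ , v∈₁) with ∈-map⁻ (𝟎 ∷_) v∈₀ | ∈-map⁻ (𝟏 ∷_) v∈₁
  ... | _ , _ , refl | _ , _ , ()

length-allWords : ∀ n → length (allWords 2 n) ≡ 2 ^ n
length-allWords zero = refl
length-allWords (suc n) = begin
  length (allWords 2 (suc n))                                        ≡⟨ cong length (allWords-suc n) ⟩
  length (map (𝟎 ∷_) (allWords 2 n) ++ map (𝟏 ∷_) (allWords 2 n))    ≡⟨ List.length-++ (map (𝟎 ∷_) (allWords 2 n)) ⟩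
  length (map (𝟎 ∷_) (allWords 2 n)) + length (map (𝟏 ∷_) (allWords 2 n))
    ≡⟨ cong₂ _+_ (List.length-map _ (allWords 2 n)) (List.length-map _ (allWords 2 n)) ⟩
  length (allWords 2 n) + length (allWords 2 n)                      ≡⟨ cong (λ m → m + m) (length-allWords n) ⟩
  2 ^ n + 2 ^ n                                                      ≡⟨ cong (2 ^ n +_) (ℕ.+-identityʳ (2 ^ n)) ⟨
  2 ^ suc n                                                          ∎
  where open ≡-Reasoning

chargedCount-≥ : ∀ ρ w {F : List Word} → Unique F →
  (∀ {v} → v ∈ F → length v ≡ w + 2 × Charged ρ v) → length F ≤ chargedCount ρ w
chargedCount-≥ ρ w F! charged = Unique-⊆⇒length≤ F! λ {v} v∈F →
  let (len , ch) = charged v∈F in ∈-filter⁺ (charged? ρ) (subst (λ n → v ∈ allWords 2 n) len (∈-allWords v)) ch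

chargedCount-≤ : ∀ ρ w {L : List Word} →
  (∀ {v} → length v ≡ w + 2 → Charged ρ v → v ∈ L) → chargedCount ρ w ≤ length L
chargedCount-≤ ρ w charged⊆L = Unique-⊆⇒length≤ (Unique.filter⁺ (charged? ρ) (allWords-unique (w + 2))) λ v∈ →
  let (v∈all , ch) = ∈-filter⁻ (charged? ρ) v∈ in charged⊆L (∈-allWords⇒length v∈all) ch

minKmerOf-head : ∀ t ρ s → countOf s t ≢ none → minKmerOf (t ∷ ρ) s ≡ just t
minKmerOf-head t ρ s t∈s with countOf s t ≟C none
... | yes t∉s = ⊥-elim (t∈s t∉s)
... | no _ = refl

prefixFamily : Bit → Bit → ℕ → List Word
prefixFamily x y w = map (λ u → x ∷ y ∷ u) (allWords 2 w)

prefixFamily-unique : ∀ x y w → Unique (prefixFamily x y w)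
prefixFamily-unique x y w = Unique.map⁺ (List.∷-injectiveʳ ∘ List.∷-injectiveʳ) (allWords-unique w)

length-prefixFamily : ∀ x y w → length (prefixFamily x y w) ≡ 2 ^ w
length-prefixFamily x y w = trans (List.length-map _ (allWords 2 w)) (length-allWords w)

∈-prefixFamily⁻ : ∀ {x y w v} → v ∈ prefixFamily x y w → ∃[ u ] (v ≡ x ∷ y ∷ u × length u ≡ w)
∈-prefixFamily⁻ {x} {y} v∈ with ∈-map⁻ (λ u → x ∷ y ∷ u) v∈
... | u , u∈ , v≡ = u , v≡ , ∈-allWords⇒length u∈

∈-prefixFamily⁺ : ∀ x y {w u} → length u ≡ w → x ∷ y ∷ u ∈ prefixFamily x y w
∈-prefixFamily⁺ x y {u = u} refl = ∈-map⁺ (λ u → x ∷ y ∷ u) (∈-allWords u)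

prefixFamily-charged : ∀ x y ρ w {v} → v ∈ prefixFamily x y w → length v ≡ w + 2 × Charged ((x · y) ∷ ρ) v
prefixFamily-charged x y ρ w v∈ with ∈-prefixFamily⁻ {w = w} v∈
... | u , refl , len = trans (cong (2 +_) len) (ℕ.+-comm 2 w) ,
  ChargedSummary⇒Charged ((x · y) ∷ ρ) (x ∷ y ∷ u) (inj₁ (minKmerOf-head (x · y) ρ _ (count-◁◁≢none x y (summarize u))))

lastPair-++ : ∀ u a b r → lastPair (summarize (u ++ a ∷ b ∷ r)) ≡ lastPair (summarize (a ∷ b ∷ r))
lastPair-++ [] a b r = refl
lastPair-++ (_ ∷ []) a b r = refl
lastPair-++ (_ ∷ _ ∷ []) a b r = refl
lastPair-++ (_ ∷ c ∷ d ∷ u) a b r = lastPair-++ (c ∷ d ∷ u) a b r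

count-other◁ : ∀ x s → countOf (other x ◁ s) (x · x) ≡ countOf s (x · x)
count-other◁ 𝟎 s with first s
... | nothing = refl
... | just _ = refl
count-other◁ 𝟏 s with first s
... | nothing = refl
... | just _ = refl

count-x◁other◁ : ∀ x s → countOf (x ◁ other x ◁ s) (x · x) ≡ countOf s (x · x)
count-x◁other◁ 𝟎 s = count-other◁ 𝟎 s
count-x◁other◁ 𝟏 s = count-other◁ 𝟏 s

fib : ℕ → ℕ
fib 0 = 1
fib 1 = 2
fib (suc (suc n)) = fib (suc n) + fib n

xxFree : Bit → ℕ → List Word
xxFree x 0 = [] ∷ []
xxFree x 1 = (x ∷ []) ∷ (other x ∷ []) ∷ []
xxFree x (suc (suc n)) = map (other x ∷_) (xxFree x (suc n)) ++ map (λ u → x ∷ other x ∷ u) (xxFree x n)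

length-xxFree : ∀ x n → length (xxFree x n) ≡ fib n
length-xxFree x 0 = refl
length-xxFree x 1 = refl
length-xxFree x (suc (suc n)) = begin
  length (map (other x ∷_) (xxFree x (suc n)) ++ map (λ u → x ∷ other x ∷ u) (xxFree x n))
    ≡⟨ List.length-++ (map (other x ∷_) (xxFree x (suc n))) ⟩
  length (map (other x ∷_) (xxFree x (suc n))) + length (map (λ u → x ∷ other x ∷ u) (xxFree x n))
    ≡⟨ cong₂ _+_ (List.length-map _ (xxFree x (suc n))) (List.length-map _ (xxFree x n)) ⟩
  length (xxFree x (suc n)) + length (xxFree x n)
    ≡⟨ cong₂ _+_ (length-xxFree x (suc n)) (length-xxFree x n) ⟩
  fib (suc (suc n)) ∎
  where open ≡-Reasoning

xxFree-unique : ∀ x n → Unique (xxFree x n)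
xxFree-unique x 0 = [] ∷ []
xxFree-unique x 1 = ((λ e → other-≢ x (sym (List.∷-injectiveˡ e))) ∷ []) ∷ [] ∷ []
xxFree-unique x (suc (suc n)) = Unique.++⁺ (Unique.map⁺ List.∷-injectiveʳ (xxFree-unique x (suc n)))
  (Unique.map⁺ (List.∷-injectiveʳ ∘ List.∷-injectiveʳ) (xxFree-unique x n)) disjoint
  where
  disjoint : Disjoint (map (other x ∷_) (xxFree x (suc n))) (map (λ u → x ∷ other x ∷ u) (xxFree x n))
  disjoint (v∈₁ , v∈₂) with ∈-map⁻ (other x ∷_) v∈₁ | ∈-map⁻ (λ u → x ∷ other x ∷ u) v∈₂
  ... | _ , _ , refl | _ , _ , e = other-≢ x (List.∷-injectiveˡ e)

count-xx : ∀ x → countOf (summarize (x ∷ x ∷ [])) (x · x) ≡ once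
count-xx 𝟎 = refl
count-xx 𝟏 = refl

otherXX : Bit → Word
otherXX x = other x ∷ x ∷ x ∷ []

xxFree-late : ∀ x n {u} → u ∈ xxFree x n → length u ≡ n
  × countOf (summarize (u ++ otherXX x)) (x · x) ≡ once × ¬ StartsWith x x (u ++ otherXX x)
xxFree-late x 0 (here refl) = refl , trans (count-other◁ x _) (count-xx x) , λ { (_ , e) → other-≢ x (List.∷-injectiveˡ e) }
xxFree-late x 1 (here refl) = refl , trans (count-x◁other◁ x _) (count-xx x) ,
  λ { (_ , e) → other-≢ x (List.∷-injectiveˡ (List.∷-injectiveʳ e)) }
xxFree-late x 1 (there (here refl)) = refl , trans (count-other◁ x _) (trans (count-other◁ x _) (count-xx x)) ,
  λ { (_ , e) → other-≢ x (List.∷-injectiveˡ e) }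
xxFree-late x (suc (suc n)) u∈ with ∈-++⁻ (map (other x ∷_) (xxFree x (suc n))) u∈
... | inj₁ u∈₁ with ∈-map⁻ (other x ∷_) u∈₁
...   | u′ , u′∈ , refl with xxFree-late x (suc n) u′∈
...     | len , count , _ = cong suc len , trans (count-other◁ x _) count , λ { (_ , e) → other-≢ x (List.∷-injectiveˡ e) }
xxFree-late x (suc (suc n)) u∈ | inj₂ u∈₂ with ∈-map⁻ (λ u → x ∷ other x ∷ u) u∈₂
...   | u′ , u′∈ , refl with xxFree-late x n u′∈
...     | len , count , _ = cong (2 +_) len , trans (count-x◁other◁ x _) count ,
          λ { (_ , e) → other-≢ x (List.∷-injectiveˡ (List.∷-injectiveʳ e)) }

lateXXFamily : Bit → ℕ → List Word
lateXXFamily x n = map (_++ otherXX x) (xxFree x n)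

lateXXFamily-charged : ∀ x ρ n {v} → v ∈ lateXXFamily x n → length v ≡ suc n + 2 × Charged ((x · x) ∷ ρ) v
lateXXFamily-charged x ρ n v∈ with ∈-map⁻ (_++ otherXX x) v∈
... | u , u∈ , refl with xxFree-late x n u∈
... | len , count , _ = length-v , ChargedSummary⇒Charged ((x · x) ∷ ρ) (u ++ otherXX x) (inj₂ (min≡last , last-once))
  where
  s = summarize (u ++ otherXX x)
  last≡xx : lastPair s ≡ just (x · x)
  last≡xx = lastPair-++ u (other x) x (x ∷ [])
  min≡last : minKmerOf ((x · x) ∷ ρ) s ≡ lastPair s
  min≡last = trans (minKmerOf-head (x · x) ρ s λ e → bump≢none none (trans (sym count) e)) (sym last≡xx)
  last-once : lastPairCount s ≡ once
  last-once = trans (cong (maybe (countOf s) none) last≡xx) count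
  length-v : length (u ++ otherXX x) ≡ suc n + 2
  length-v = trans (List.length-++ u) (trans (cong (_+ 3) len) (ℕ.+-suc n 2))

xxHead-chargedCount-≥ : ∀ x ρ n → 2 ^ suc n + fib n ≤ chargedCount ((x · x) ∷ ρ) (suc n)
xxHead-chargedCount-≥ x ρ n = subst (_≤ chargedCount ((x · x) ∷ ρ) (suc n)) length-F (chargedCount-≥ _ (suc n) F! F-charged)
  where
  P = prefixFamily x x (suc n)
  L = lateXXFamily x n
  length-F : length (P ++ L) ≡ 2 ^ suc n + fib n
  length-F = trans (List.length-++ P) (cong₂ _+_ (length-prefixFamily x x (suc n))
    (trans (List.length-map _ (xxFree x n)) (length-xxFree x n)))
  disjoint : Disjoint P L
  disjoint (v∈P , v∈L) with ∈-prefixFamily⁻ {w = suc n} v∈P | ∈-map⁻ (_++ otherXX x) v∈L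
  ... | u , v≡ , _ | u′ , u′∈ , refl = proj₂ (proj₂ (xxFree-late x n u′∈)) (u , v≡)
  F! : Unique (P ++ L)
  F! = Unique.++⁺ (prefixFamily-unique x x (suc n))
    (Unique.map⁺ (List.++-cancelʳ (otherXX x) _ _) (xxFree-unique x n)) disjoint
  F-charged : ∀ {v} → v ∈ P ++ L → length v ≡ suc n + 2 × Charged ((x · x) ∷ ρ) v
  F-charged v∈ with ∈-++⁻ P v∈
  ... | inj₁ v∈P = prefixFamily-charged x x ρ (suc n) v∈P
  ... | inj₂ v∈L = lateXXFamily-charged x ρ n v∈L

fib-pos : ∀ n → 1 ≤ fib n
fib-pos 0 = s≤s z≤n
fib-pos 1 = s≤s z≤n
fib-pos (suc (suc n)) = ℕ.≤-trans (fib-pos (suc n)) (ℕ.m≤m+n _ _)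

fib-linear : ∀ n → 12 + n ≤ fib (5 + n)
fib-linear 0 = ℕ.n≤1+n 12
fib-linear (suc n) = ℕ.≤-trans (ℕ.≤-reflexive (ℕ.+-comm 1 (12 + n))) (ℕ.+-mono-≤ (fib-linear n) (fib-pos (4 + n)))

xxHead-bound<chargedCount : ∀ x ρ w → 6 ≤ w → 2 ^ w + w + 5 < chargedCount ((x · x) ∷ ρ) w
xxHead-bound<chargedCount x ρ w (s≤s (s≤s (s≤s (s≤s (s≤s (s≤s {n = n} z≤n)))))) = begin-strict
  2 ^ w + w + 5      ≡⟨ ℕ.+-assoc (2 ^ w) w 5 ⟩
  2 ^ w + (w + 5)    <⟨ ℕ.+-monoʳ-< (2 ^ w) (ℕ.≤-reflexive (cong (7 +_) (ℕ.+-comm n 5))) ⟩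
  2 ^ w + (12 + n)   ≤⟨ ℕ.+-monoʳ-≤ (2 ^ w) (fib-linear n) ⟩
  2 ^ w + fib (5 + n) ≤⟨ xxHead-chargedCount-≥ x ρ (5 + n) ⟩
  chargedCount ((x · x) ∷ ρ) w ∎
  where open ℕ.≤-Reasoning

xySuffixFamily : Bit → Bit → ℕ → List Word
xySuffixFamily x y 0 = (x ∷ y ∷ []) ∷ []
xySuffixFamily x y (suc m) = runs y 0 x (2 + m) (y ∷ []) ∷ map (y ∷_) (xySuffixFamily x y m)

length-xySuffixFamily : ∀ x y m → length (xySuffixFamily x y m) ≡ suc m
length-xySuffixFamily x y 0 = refl
length-xySuffixFamily x y (suc m) = cong suc (trans (List.length-map _ (xySuffixFamily x y m)) (length-xySuffixFamily x y m))

∈-xySuffixFamily⁻ : ∀ {x y} m {v} → v ∈ xySuffixFamily x y m → ∃₂ λ a b → a + b ≡ m × v ≡ runs y a x (suc b) (y ∷ [])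
∈-xySuffixFamily⁻ 0 (here refl) = 0 , 0 , refl , refl
∈-xySuffixFamily⁻ (suc m) (here refl) = 0 , suc m , refl , refl
∈-xySuffixFamily⁻ {y = y} (suc m) (there v∈) with ∈-map⁻ (y ∷_) v∈
... | _ , v′∈ , refl with ∈-xySuffixFamily⁻ m v′∈
... | a , b , refl , refl = suc a , b , refl , refl

∈-xySuffixFamily⁺ : ∀ x y a b → runs y a x (suc b) (y ∷ []) ∈ xySuffixFamily x y (a + b)
∈-xySuffixFamily⁺ x y 0 0 = here refl
∈-xySuffixFamily⁺ x y 0 (suc b) = here refl
∈-xySuffixFamily⁺ x y (suc a) b = there (∈-map⁺ (y ∷_) (∈-xySuffixFamily⁺ x y a b))

xySuffixFamily-unique : ∀ {x y} → x ≢ y → ∀ m → Unique (xySuffixFamily x y m)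
xySuffixFamily-unique x≢y 0 = [] ∷ []
xySuffixFamily-unique {x} {y} x≢y (suc m) =
  All.tabulate (λ v∈ e → x≢y (head≡ v∈ e)) ∷ Unique.map⁺ List.∷-injectiveʳ (xySuffixFamily-unique x≢y m)
  where
  head≡ : ∀ {v} → v ∈ map (y ∷_) (xySuffixFamily x y m) → runs y 0 x (2 + m) (y ∷ []) ≡ v → x ≡ y
  head≡ v∈ e with ∈-map⁻ (y ∷_) v∈
  ... | _ , _ , refl = List.∷-injectiveˡ e

xySuffixFamily-length : ∀ {x y} m {v} → v ∈ xySuffixFamily x y m → length v ≡ m + 2
xySuffixFamily-length {x} {y} m v∈ with ∈-xySuffixFamily⁻ m v∈
... | a , b , refl , refl =
  trans (length-runs y a x (suc b) (y ∷ [])) (trans (cong (a +_) (sym (ℕ.+-suc b 1))) (sym (ℕ.+-assoc a b 2)))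

-- The exponents (3 ⊓ a , 3 ⊓ (1 + b)) of the words y^a x^(1 + b) y with a + b ≥ 2.
cappedPairs : List (ℕ × ℕ)
cappedPairs = (0 , 3) ∷ (1 , 1) ∷ (1 , 2) ∷ (1 , 3) ∷ (2 , 1) ∷ (2 , 2) ∷ (2 , 3) ∷ (3 , 1) ∷ (3 , 2) ∷ (3 , 3) ∷ []

cap-∈-cappedPairs : ∀ a b → 2 ≤ a + b → (3 ⊓ a , 3 ⊓ suc b) ∈ cappedPairs
cap-∈-cappedPairs 0 (suc (suc b)) _ = here refl
cap-∈-cappedPairs 1 0 _ = there (here refl)
cap-∈-cappedPairs 1 1 _ = there (there (here refl))
cap-∈-cappedPairs 1 (suc (suc b)) _ = there (there (there (here refl)))
cap-∈-cappedPairs 2 0 _ = there (there (there (there (here refl))))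
cap-∈-cappedPairs 2 1 _ = there (there (there (there (there (here refl)))))
cap-∈-cappedPairs 2 (suc (suc b)) _ = there (there (there (there (there (there (here refl))))))
cap-∈-cappedPairs (suc (suc (suc a))) 0 _ = there (there (there (there (there (there (there (here refl)))))))
cap-∈-cappedPairs (suc (suc (suc a))) 1 _ = there (there (there (there (there (there (there (there (here refl))))))))
cap-∈-cappedPairs (suc (suc (suc a))) (suc (suc b)) _ =
  there (there (there (there (there (there (there (there (there (here refl)))))))))
cap-∈-cappedPairs 0 0 ()
cap-∈-cappedPairs 0 1 (s≤s ())

xySuffixSummaries : Bit → Bit → List Summary
xySuffixSummaries x y = map (λ p → summarize (runs y (proj₁ p) x (proj₂ p) (y ∷ []))) cappedPairs

xySuffixFamily-summary : ∀ {x y} m → 2 ≤ m → ∀ {v} → v ∈ xySuffixFamily x y m → summarize v ∈ xySuffixSummaries x y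
xySuffixFamily-summary {x} {y} m 2≤m v∈ with ∈-xySuffixFamily⁻ m v∈
... | a , b , refl , refl = subst (_∈ xySuffixSummaries x y) (sym (summarize-runs y a x (suc b) (y ∷ [])))
  (∈-map⁺ (λ p → summarize (runs y (proj₁ p) x (proj₂ p) (y ∷ []))) (cap-∈-cappedPairs a b 2≤m))

-- Which of y x^(1 + w) and y^w x x is charged depends on whether yx precedes xx.
lastTwoRun : Bit → Bit → Bool → ℕ → Word
lastTwoRun x y true w = runs y 1 x (1 + w) []
lastTwoRun x y false w = runs y w x 2 []

twoRunWords : Bit → Bit → Bool → ℕ → List Word
twoRunWords x y yxFirst w = runs y 0 x (2 + w) [] ∷ runs y (2 + w) x 0 [] ∷ runs y (1 + w) x 1 [] ∷ lastTwoRun x y yxFirst w ∷ []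

twoRunWords-length : ∀ x y yxFirst w {v} → v ∈ twoRunWords x y yxFirst w → length v ≡ w + 2
twoRunWords-length x y yxFirst w (here refl) = trans (length-runs y 0 x (2 + w) []) (trans (ℕ.+-identityʳ (2 + w)) (ℕ.+-comm 2 w))
twoRunWords-length x y yxFirst w (there (here refl)) =
  trans (length-runs y (2 + w) x 0 []) (trans (ℕ.+-identityʳ (2 + w)) (ℕ.+-comm 2 w))
twoRunWords-length x y yxFirst w (there (there (here refl))) = trans (length-runs y (1 + w) x 1 []) (sym (ℕ.+-suc w 1))
twoRunWords-length x y true w (there (there (there (here refl)))) =
  trans (length-runs y 1 x (1 + w) []) (trans (cong (2 +_) (ℕ.+-identityʳ w)) (ℕ.+-comm 2 w))
twoRunWords-length x y false w (there (there (there (here refl)))) = length-runs y w x 2 []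

twoRunWords-summaries : ∀ x y yxFirst k →
  map summarize (twoRunWords x y yxFirst (3 + k)) ≡ map summarize (twoRunWords x y yxFirst 3)
twoRunWords-summaries x y yxFirst k = cong₂ _∷_ (capped 0 (5 + k) 0 5 refl refl) $ cong₂ _∷_ (capped (5 + k) 0 5 0 refl refl) $
  cong₂ _∷_ (capped (4 + k) 1 4 1 refl refl) $ cong (_∷ []) (lastTwoRun-capped yxFirst)
  where
  capped : ∀ a b a′ b′ → 3 ⊓ a ≡ 3 ⊓ a′ → 3 ⊓ b ≡ 3 ⊓ b′ → summarize (runs y a x b []) ≡ summarize (runs y a′ x b′ [])
  capped a b a′ b′ = summarize-runs-cap y a x b []
  lastTwoRun-capped : ∀ yxFirst → summarize (lastTwoRun x y yxFirst (3 + k)) ≡ summarize (lastTwoRun x y yxFirst 3)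
  lastTwoRun-capped true = capped 1 (4 + k) 1 4 refl refl
  lastTwoRun-capped false = capped (3 + k) 2 3 2 refl refl

_≟S_ : (s t : Summary) → Dec (s ≡ t)
summary a b c d e f g ≟S summary a′ b′ c′ d′ e′ f′ g′ =
  map′ (λ { (refl , refl , refl , refl , refl , refl , refl) → refl })
       (λ { refl → refl , refl , refl , refl , refl , refl , refl })
       (Maybe.≡-dec _≟_ a a′ ×-dec Maybe.≡-dec _≟_ b b′ ×-dec Maybe.≡-dec _≟K_ c c′
         ×-dec d ≟C d′ ×-dec e ≟C e′ ×-dec f ≟C f′ ×-dec g ≟C g′)

twoRunSummaries : Bit → Bit → Bool → List Summary
twoRunSummaries x y yxFirst = map summarize (twoRunWords x y yxFirst 3)

RunSummariesSeparated : Bit → Bit → Bool → Set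
RunSummariesSeparated x y yxFirst =
  Unique (twoRunSummaries x y yxFirst)
  × All (_∉ twoRunSummaries x y yxFirst) (xySuffixSummaries x y)
  × All (λ s → prefixOf s ≢ just (x · y)) (xySuffixSummaries x y ++ twoRunSummaries x y yxFirst)

runSummariesSeparated? : ∀ x y yxFirst → Dec (RunSummariesSeparated x y yxFirst)
runSummariesSeparated? x y yxFirst =
  unique? _≟S_ (twoRunSummaries x y yxFirst)
  ×-dec All.all? (λ s → ¬? (s ∈? twoRunSummaries x y yxFirst)) (xySuffixSummaries x y)
  ×-dec All.all? (λ s → ¬? (Maybe.≡-dec _≟K_ (prefixOf s) (just (x · y)))) (xySuffixSummaries x y ++ twoRunSummaries x y yxFirst)
  where open import Data.List.Membership.DecPropositional _≟S_ using (_∈?_)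

runSummariesSeparated : ∀ {x y} → x ≢ y → ∀ yxFirst → RunSummariesSeparated x y yxFirst
runSummariesSeparated {𝟎} {𝟏} _ true = from-yes (runSummariesSeparated? 𝟎 𝟏 true)
runSummariesSeparated {𝟎} {𝟏} _ false = from-yes (runSummariesSeparated? 𝟎 𝟏 false)
runSummariesSeparated {𝟏} {𝟎} _ true = from-yes (runSummariesSeparated? 𝟏 𝟎 true)
runSummariesSeparated {𝟏} {𝟎} _ false = from-yes (runSummariesSeparated? 𝟏 𝟎 false)
runSummariesSeparated {𝟎} {𝟎} x≢y = ⊥-elim (x≢y refl)
runSummariesSeparated {𝟏} {𝟏} x≢y = ⊥-elim (x≢y refl)

xyHeadWords : Bit → Bit → Bool → ℕ → List Word
xyHeadWords x y yxFirst w = prefixFamily x y w ++ (xySuffixFamily x y w ++ twoRunWords x y yxFirst w)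

length-xyHeadWords : ∀ x y yxFirst w → length (xyHeadWords x y yxFirst w) ≡ 2 ^ w + w + 5
length-xyHeadWords x y yxFirst w = begin
  length (P ++ (S ++ T))               ≡⟨ List.length-++ P ⟩
  length P + length (S ++ T)           ≡⟨ cong (length P +_) (List.length-++ S) ⟩
  length P + (length S + length T)     ≡⟨ cong₂ (λ m n → m + (n + 4)) (length-prefixFamily x y w) (length-xySuffixFamily x y w) ⟩
  2 ^ w + (suc w + 4)                  ≡⟨ cong (2 ^ w +_) (ℕ.+-suc w 4) ⟨
  2 ^ w + (w + 5)                      ≡⟨ ℕ.+-assoc (2 ^ w) w 5 ⟨
  2 ^ w + w + 5                        ∎
  where
  open ≡-Reasoning
  P = prefixFamily x y w
  S = xySuffixFamily x y w
  T = twoRunWords x y yxFirst w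

runSummaries : Bit → Bit → Bool → List Summary
runSummaries x y yxFirst = xySuffixSummaries x y ++ twoRunSummaries x y yxFirst

twoRunWords-summary : ∀ x y yxFirst k {v} → v ∈ twoRunWords x y yxFirst (3 + k) → summarize v ∈ twoRunSummaries x y yxFirst
twoRunWords-summary x y yxFirst k {v} v∈ = subst (summarize v ∈_) (twoRunWords-summaries x y yxFirst k) (∈-map⁺ summarize v∈)

xyHeadWords-summary : ∀ x y yxFirst k {v} → v ∈ xySuffixFamily x y (3 + k) ++ twoRunWords x y yxFirst (3 + k) →
  summarize v ∈ runSummaries x y yxFirst
xyHeadWords-summary x y yxFirst k v∈ with ∈-++⁻ (xySuffixFamily x y (3 + k)) v∈
... | inj₁ v∈S = ∈-++⁺ˡ (xySuffixFamily-summary (3 + k) (s≤s (s≤s z≤n)) v∈S)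
... | inj₂ v∈T = ∈-++⁺ʳ (xySuffixSummaries x y) (twoRunWords-summary x y yxFirst k v∈T)

xyHeadWords-unique : ∀ {x y} → x ≢ y → ∀ yxFirst k → Unique (xyHeadWords x y yxFirst (3 + k))
xyHeadWords-unique {x} {y} x≢y yxFirst k =
  Unique.++⁺ (prefixFamily-unique x y w) (Unique.++⁺ (xySuffixFamily-unique x≢y w) T! S∩T) P∩S++T
  where
  w = 3 + k
  P = prefixFamily x y w
  S = xySuffixFamily x y w
  T = twoRunWords x y yxFirst w
  separated = runSummariesSeparated x≢y yxFirst
  T! : Unique T
  T! = Unique.map⁻ {f = summarize} (subst Unique (sym (twoRunWords-summaries x y yxFirst k)) (proj₁ separated))
  S∩T : Disjoint S T
  S∩T (v∈S , v∈T) =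
    All.lookup (proj₁ (proj₂ separated)) (xySuffixFamily-summary w (s≤s (s≤s z≤n)) v∈S) (twoRunWords-summary x y yxFirst k v∈T)
  P∩S++T : Disjoint P (S ++ T)
  P∩S++T (v∈P , v∈S++T) with ∈-prefixFamily⁻ {w = w} v∈P
  ... | u , refl , _ = All.lookup (proj₂ (proj₂ separated)) (xyHeadWords-summary x y yxFirst k v∈S++T) refl

xyHead-chargedCount-≥ : ∀ {x y} ρ yxFirst → x ≢ y → All (ChargedSummary ((x · y) ∷ ρ)) (runSummaries x y yxFirst) →
  ∀ k → 2 ^ (3 + k) + (3 + k) + 5 ≤ chargedCount ((x · y) ∷ ρ) (3 + k)
xyHead-chargedCount-≥ {x} {y} ρ yxFirst x≢y charged k =
  subst (_≤ chargedCount ((x · y) ∷ ρ) w) (length-xyHeadWords x y yxFirst w)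
    (chargedCount-≥ _ w (xyHeadWords-unique x≢y yxFirst k) words-charged)
  where
  w = 3 + k
  words-charged : ∀ {v} → v ∈ xyHeadWords x y yxFirst w → length v ≡ w + 2 × Charged ((x · y) ∷ ρ) v
  words-charged {v} v∈ with ∈-++⁻ (prefixFamily x y w) v∈
  ... | inj₁ v∈P = prefixFamily-charged x y ρ w v∈P
  ... | inj₂ v∈S++T = length-v ,
    ChargedSummary⇒Charged ((x · y) ∷ ρ) v (All.lookup charged (xyHeadWords-summary x y yxFirst k v∈S++T))
    where
    length-v : length v ≡ w + 2
    length-v with ∈-++⁻ (xySuffixFamily x y w) v∈S++T
    ... | inj₁ v∈S = xySuffixFamily-length w v∈S
    ... | inj₂ v∈T = twoRunWords-length x y yxFirst w v∈T

dimers : List Dimer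
dimers = 𝟎 · 𝟎 ∷ 𝟎 · 𝟏 ∷ 𝟏 · 𝟎 ∷ 𝟏 · 𝟏 ∷ []

∈-dimers : ∀ t → t ∈ dimers
∈-dimers (𝟎 · 𝟎) = here refl
∈-dimers (𝟎 · 𝟏) = there (here refl)
∈-dimers (𝟏 · 𝟎) = there (there (here refl))
∈-dimers (𝟏 · 𝟏) = there (there (there (here refl)))

linearOrders : List (Arrangement 2 2)
linearOrders = filter (unique? _≟K_) (lists dimers 4)

linearOrder∈linearOrders : ∀ {τ} → IsLinearOrder τ → τ ∈ linearOrders
linearOrder∈linearOrders {τ} (τ! , all∈τ) = ∈-filter⁺ (unique? _≟K_) (subst (λ n → τ ∈ lists dimers n) length≡4 τ∈lists) τ!
  where
  τ∈lists : τ ∈ lists dimers (length τ)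
  τ∈lists = ∈-lists (All.tabulate λ {t} _ → ∈-dimers t)
  length≡4 : length τ ≡ 4
  length≡4 = ℕ.≤-antisym (Unique-⊆⇒length≤ τ! λ {t} _ → ∈-dimers t)
                         (Unique-⊆⇒length≤ (from-yes (unique? _≟K_ dimers)) λ {t} _ → all∈τ t)

linearOrder-UHS : ∀ {τ} → IsLinearOrder {2} {2} τ → ∀ w → 1 ≤ w → IsUHS τ w
linearOrder-UHS (_ , all∈τ) (suc w) _ (a ∷ b ∷ s) _ = a · b , all∈τ (a · b) , here refl
linearOrder-UHS _ (suc w) _ (a ∷ []) len = ⊥-elim (ℕ.0≢1+n (ℕ.suc-injective (trans len (ℕ.+-comm w 2))))
linearOrder-UHS _ (suc w) _ [] len = ⊥-elim (ℕ.0≢1+n (trans len (ℕ.+-comm w 2)))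

ChargedCountBound : Arrangement 2 2 → ℕ → Set
ChargedCountBound τ w = 2 ^ w + w + 5 ≤ chargedCount τ w

-- The part of the lower bound not covered by `xxHead-bound<chargedCount` and
-- `xyHead-chargedCount-≥`: the widths below 6 (head xx) or 3 (head xy), and the charged-ness of
-- the finitely many summaries of the xy families. It is checked by evaluation for all 24 orders.
LowerBoundCertificate : Arrangement 2 2 → Set
LowerBoundCertificate [] = ⊥
LowerBoundCertificate τ@((x · y) ∷ _) with x ≟ y
... | yes _ = All (ChargedCountBound τ) (2 ∷ 3 ∷ 4 ∷ 5 ∷ [])
... | no _ = ChargedCountBound τ 2
  × (All (ChargedSummary τ) (runSummaries x y true) ⊎ All (ChargedSummary τ) (runSummaries x y false))

lowerBoundCertificate? : ∀ τ → Dec (LowerBoundCertificate τ)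
lowerBoundCertificate? [] = no λ ()
lowerBoundCertificate? τ@((x · y) ∷ _) with x ≟ y
... | yes _ = All.all? (λ w → _ ℕ.≤? chargedCount τ w) _
... | no _ = (_ ℕ.≤? _) ×-dec (All.all? (chargedSummary? τ) _ ⊎-dec All.all? (chargedSummary? τ) _)

linearOrders-certified : All LowerBoundCertificate linearOrders
linearOrders-certified = from-yes (All.all? lowerBoundCertificate? linearOrders)

from-2-5-and-≥6 : ∀ {P : ℕ → Set} → All P (2 ∷ 3 ∷ 4 ∷ 5 ∷ []) → (∀ w → 6 ≤ w → P w) → ∀ w → 2 ≤ w → P w
from-2-5-and-≥6 (p₂ ∷ _) _ 2 _ = p₂
from-2-5-and-≥6 (_ ∷ p₃ ∷ _) _ 3 _ = p₃
from-2-5-and-≥6 (_ ∷ _ ∷ p₄ ∷ _) _ 4 _ = p₄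
from-2-5-and-≥6 (_ ∷ _ ∷ _ ∷ p₅ ∷ _) _ 5 _ = p₅
from-2-5-and-≥6 _ p≥6 w@(suc (suc (suc (suc (suc (suc _)))))) _ = p≥6 w (s≤s (s≤s (s≤s (s≤s (s≤s (s≤s z≤n))))))
from-2-5-and-≥6 _ _ 0 ()
from-2-5-and-≥6 _ _ 1 (s≤s ())

from-2-and-≥3 : ∀ {P : ℕ → Set} → P 2 → (∀ k → P (3 + k)) → ∀ w → 2 ≤ w → P w
from-2-and-≥3 p₂ _ 2 _ = p₂
from-2-and-≥3 _ p≥3 (suc (suc (suc k))) _ = p≥3 k
from-2-and-≥3 _ _ 0 ()
from-2-and-≥3 _ _ 1 (s≤s ())

certificate⇒chargedCountBound : ∀ τ → LowerBoundCertificate τ → ∀ w → 2 ≤ w → ChargedCountBound τ w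
certificate⇒chargedCountBound ((x · y) ∷ ρ) cert with x ≟ y
... | yes refl = from-2-5-and-≥6 cert λ w 6≤w → ℕ.<⇒≤ (xxHead-bound<chargedCount x ρ w 6≤w)
... | no x≢y with cert
...   | bound₂ , inj₁ charged = from-2-and-≥3 bound₂ (xyHead-chargedCount-≥ ρ true x≢y charged)
...   | bound₂ , inj₂ charged = from-2-and-≥3 bound₂ (xyHead-chargedCount-≥ ρ false x≢y charged)

linearOrder-chargedCount-≥ : ∀ τ → IsLinearOrder τ → ∀ w → 2 ≤ w → 2 ^ w + w + 5 ≤ chargedCount τ w
linearOrder-chargedCount-≥ τ lin =
  certificate⇒chargedCountBound τ (All.lookup linearOrders-certified (linearOrder∈linearOrders lin))

ρ₀ : Arrangement 2 2
ρ₀ = 𝟎 · 𝟏 ∷ 𝟏 · 𝟎 ∷ 𝟎 · 𝟎 ∷ 𝟏 · 𝟏 ∷ []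

ρ₀-linear : IsLinearOrder ρ₀
ρ₀-linear = from-yes (unique? _≟K_ ρ₀) , λ { (𝟎 · 𝟎) → there (there (here refl)) ; (𝟎 · 𝟏) → here refl
                                           ; (𝟏 · 𝟎) → there (here refl) ; (𝟏 · 𝟏) → there (there (there (here refl))) }

uniqueLast01⇒runs : ∀ v → lastPair (summarize v) ≡ just (𝟎 · 𝟏) → countOf (summarize v) (𝟎 · 𝟏) ≡ once →
  ∃₂ λ a b → v ≡ runs 𝟏 a 𝟎 (suc b) (𝟏 ∷ [])
uniqueLast01⇒runs (𝟎 ∷ 𝟏 ∷ []) refl _ = 0 , 0 , refl
uniqueLast01⇒runs (𝟎 ∷ 𝟏 ∷ c ∷ v) last≡ once≡ = ⊥-elim (lastPair-count≢none (𝟏 ∷ c ∷ v) last≡ (bump-once once≡))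
  where
  bump-once : ∀ {c} → bump c ≡ once → c ≡ none
  bump-once {none} _ = refl
uniqueLast01⇒runs (𝟎 ∷ 𝟎 ∷ c ∷ v) last≡ once≡ with uniqueLast01⇒runs (𝟎 ∷ c ∷ v) last≡ once≡
... | 0 , b , e = 0 , suc b , cong (𝟎 ∷_) e
... | suc _ , _ , ()
uniqueLast01⇒runs (𝟏 ∷ b ∷ c ∷ v) last≡ once≡ with uniqueLast01⇒runs (b ∷ c ∷ v) last≡ once≡
... | a , b , e = suc a , b , cong (𝟏 ∷_) e
uniqueLast01⇒runs (𝟎 ∷ 𝟎 ∷ []) () _
uniqueLast01⇒runs (𝟏 ∷ _ ∷ []) () _

ρ₀-charged-twoRun : ∀ w a b → a + b ≡ w + 2 → ChargedSummary ρ₀ (summarize (runs 𝟏 a 𝟎 b [])) →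
  runs 𝟏 a 𝟎 b [] ∈ twoRunWords 𝟎 𝟏 true w
ρ₀-charged-twoRun w 0 b len _ =
  subst (λ b → runs 𝟏 0 𝟎 b [] ∈ twoRunWords 𝟎 𝟏 true w) (sym (trans len (ℕ.+-comm w 2))) (here refl)
ρ₀-charged-twoRun w a@(suc _) 0 len _ =
  subst (λ a → runs 𝟏 a 𝟎 0 [] ∈ twoRunWords 𝟎 𝟏 true w) (sym (trans (sym (ℕ.+-identityʳ a)) (trans len (ℕ.+-comm w 2))))
    (there (here refl))
ρ₀-charged-twoRun w a@(suc _) 1 len _ =
  subst (λ a → runs 𝟏 a 𝟎 1 [] ∈ twoRunWords 𝟎 𝟏 true w) (sym (ℕ.+-cancelʳ-≡ 1 a (suc w) (trans len (ℕ.+-suc w 1))))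
    (there (there (here refl)))
ρ₀-charged-twoRun w 1 b@(suc (suc _)) len _ =
  subst (λ b → runs 𝟏 1 𝟎 b [] ∈ twoRunWords 𝟎 𝟏 true w) (sym (ℕ.suc-injective (trans len (ℕ.+-comm w 2))))
    (there (there (there (here refl))))
ρ₀-charged-twoRun w (suc (suc a)) (suc (suc b)) _ charged =
  ⊥-elim (notCharged a b (subst (ChargedSummary ρ₀) (summarize-runs 𝟏 (2 + a) 𝟎 (2 + b) []) charged))
  where
  -- The minimum of y^a x^b with a, b ≥ 2 under ρ₀ is yx = 10, which is neither prefix nor suffix.
  notCharged : ∀ a b → ¬ ChargedSummary ρ₀ (summarize (runs 𝟏 (3 ⊓ (2 + a)) 𝟎 (3 ⊓ (2 + b)) []))
  notCharged 0 0 = from-no (chargedSummary? ρ₀ (summarize (runs 𝟏 2 𝟎 2 [])))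
  notCharged 0 (suc _) = from-no (chargedSummary? ρ₀ (summarize (runs 𝟏 2 𝟎 3 [])))
  notCharged (suc _) 0 = from-no (chargedSummary? ρ₀ (summarize (runs 𝟏 3 𝟎 2 [])))
  notCharged (suc _) (suc _) = from-no (chargedSummary? ρ₀ (summarize (runs 𝟏 3 𝟎 3 [])))

ρ₀-charged⊆ : ∀ w {v} → length v ≡ w + 2 → Charged ρ₀ v → v ∈ xyHeadWords 𝟎 𝟏 true w
ρ₀-charged⊆ w {v} len charged = dispatch (countOf s (𝟎 · 𝟏) ≟C none) (Charged⇒ChargedSummary ρ₀ v charged)
  where
  s = summarize v
  P = prefixFamily 𝟎 𝟏 w
  S = xySuffixFamily 𝟎 𝟏 w
  dispatch : Dec (countOf s (𝟎 · 𝟏) ≡ none) → ChargedSummary ρ₀ s → v ∈ xyHeadWords 𝟎 𝟏 true w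
  dispatch (no 01∈v) (inj₁ min≡prefix) with prefixOf-summarize⁻ v (trans (sym min≡prefix) (minKmerOf-head (𝟎 · 𝟏) _ s 01∈v))
  ... | u , refl = ∈-++⁺ˡ (∈-prefixFamily⁺ 𝟎 𝟏 (ℕ.+-cancelʳ-≡ 2 (length u) w (trans (ℕ.+-comm (length u) 2) len)))
  dispatch (no 01∈v) (inj₂ (min≡last , last-once)) =
    let last≡01 = trans (sym min≡last) (minKmerOf-head (𝟎 · 𝟏) _ s 01∈v)
        (a , b , v≡runs) = uniqueLast01⇒runs v last≡01 (trans (cong (maybe (countOf s) none) (sym last≡01)) last-once)
    in ∈-++⁺ʳ P (∈-++⁺ˡ (suffix∈ a b v≡runs))
    where
    suffix∈ : ∀ a b → v ≡ runs 𝟏 a 𝟎 (suc b) (𝟏 ∷ []) → v ∈ S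
    suffix∈ a b refl = subst (λ m → v ∈ xySuffixFamily 𝟎 𝟏 m) a+b≡w (∈-xySuffixFamily⁺ 𝟎 𝟏 a b)
      where
      a+b≡w : a + b ≡ w
      a+b≡w = ℕ.+-cancelʳ-≡ 2 (a + b) w (trans (sym (xySuffixFamily-length (a + b) (∈-xySuffixFamily⁺ 𝟎 𝟏 a b))) len)
  dispatch (yes 01∉v) charged′ with avoids⇒runs {𝟎} {𝟏} (λ ()) v (λ occ → Occurs⇒count≢none v occ 01∉v)
  ... | a , b , refl = ∈-++⁺ʳ P (∈-++⁺ʳ S (ρ₀-charged-twoRun w a b a+b≡w+2 charged′))
    where
    a+b≡w+2 : a + b ≡ w + 2
    a+b≡w+2 = trans (cong (a +_) (sym (ℕ.+-identityʳ b))) (trans (sym (length-runs 𝟏 a 𝟎 b [])) len)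

ρ₀-chargedCount : ∀ w → 2 ≤ w → chargedCount ρ₀ w ≡ 2 ^ w + w + 5
ρ₀-chargedCount w 2≤w = ℕ.≤-antisym
  (subst (chargedCount ρ₀ w ≤_) (length-xyHeadWords 𝟎 𝟏 true w) (chargedCount-≤ ρ₀ w (ρ₀-charged⊆ w)))
  (linearOrder-chargedCount-≥ ρ₀ ρ₀-linear w 2≤w)

ρ₀-InU : InU ρ₀
ρ₀-InU = proj₁ ρ₀-linear , 1 , ℕ.≤-refl , linearOrder-UHS ρ₀-linear 1 ℕ.≤-refl

module _ (d : ℕ) .{{_ : NonZero d}} where
  private
    g : ℕ → ℕ
    g n = gcd n d

    g²-pos : ∀ n m → ℤ.Positive (ℤ.+ (g n * g m))
    g²-pos n m = ℤ.positive (ℤ.+<+ (>-nonZero⁻¹ (g n * g m) {{ℕ.m*n≢0 (g n) (g m) {{gcd≢0 n}} {{gcd≢0 m}}}}))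
      where
      gcd≢0 : ∀ n → NonZero (g n)
      gcd≢0 n = ≢-nonZero (gcd[m,n]≢0 n d (inj₂ (≢-nonZero⁻¹ d)))

    -- ↥ (n / d) and ↧ (n / d) are n and d divided by gcd n d.
    cross : ∀ n m → ↥ (ℤ.+ n / d) ℤ.* ↧ (ℤ.+ m / d) ℤ.* ℤ.+ (g n * g m) ≡ ℤ.+ n ℤ.* ℤ.+ d
    cross n m = begin
      ↥ p ℤ.* ↧ q ℤ.* ℤ.+ (g n * g m)          ≡⟨ cong (↥ p ℤ.* ↧ q ℤ.*_) (ℤ.pos-* (g n) (g m)) ⟩
      ↥ p ℤ.* ↧ q ℤ.* (ℤ.+ g n ℤ.* ℤ.+ g m)    ≡⟨ interchange (↥ p) (↧ q) (ℤ.+ g n) (ℤ.+ g m) ⟩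
      ↥ p ℤ.* ℤ.+ g n ℤ.* (↧ q ℤ.* ℤ.+ g m)    ≡⟨ cong₂ ℤ._*_ (ℚ.↥-/ (ℤ.+ n) d) (ℚ.↧-/ (ℤ.+ m) d) ⟩
      ℤ.+ n ℤ.* ℤ.+ d                           ∎
      where
      open ≡-Reasoning
      p = ℤ.+ n / d
      q = ℤ.+ m / d

    cross′ : ∀ n m → ↥ (ℤ.+ m / d) ℤ.* ↧ (ℤ.+ n / d) ℤ.* ℤ.+ (g n * g m) ≡ ℤ.+ m ℤ.* ℤ.+ d
    cross′ n m = trans (cong (λ k → ↥ (ℤ.+ m / d) ℤ.* ↧ (ℤ.+ n / d) ℤ.* ℤ.+ k) (ℕ.*-comm (g n) (g m))) (cross m n)

  /-mono-≤ : ∀ {n m} → n ≤ m → ℤ.+ n / d ≤ℚ ℤ.+ m / d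
  /-mono-≤ {n} {m} n≤m = *≤* $ ℤ.*-cancelʳ-≤-pos _ _ (ℤ.+ (g n * g m)) {{g²-pos n m}} $ begin
    ↥ (ℤ.+ n / d) ℤ.* ↧ (ℤ.+ m / d) ℤ.* ℤ.+ (g n * g m)   ≡⟨ cross n m ⟩
    ℤ.+ n ℤ.* ℤ.+ d                                       ≤⟨ ℤ.*-monoʳ-≤-nonNeg (ℤ.+ d) (ℤ.+≤+ n≤m) ⟩
    ℤ.+ m ℤ.* ℤ.+ d                                       ≡⟨ cross′ n m ⟨
    ↥ (ℤ.+ m / d) ℤ.* ↧ (ℤ.+ n / d) ℤ.* ℤ.+ (g n * g m)   ∎
    where open ℤ.≤-Reasoning

  /-cancel-≤ : ∀ {n m} → ℤ.+ n / d ≤ℚ ℤ.+ m / d → n ≤ m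
  /-cancel-≤ {n} {m} (*≤* le) = ℕ.*-cancelʳ-≤ n m d $ ℤ.drop‿+≤+ $ begin
    ℤ.+ (n * d)                                           ≡⟨ ℤ.pos-* n d ⟩
    ℤ.+ n ℤ.* ℤ.+ d                                       ≡⟨ cross n m ⟨
    ↥ (ℤ.+ n / d) ℤ.* ↧ (ℤ.+ m / d) ℤ.* ℤ.+ (g n * g m)   ≤⟨ ℤ.*-monoʳ-≤-nonNeg (ℤ.+ (g n * g m)) le ⟩
    ↥ (ℤ.+ m / d) ℤ.* ↧ (ℤ.+ n / d) ℤ.* ℤ.+ (g n * g m)   ≡⟨ cross′ n m ⟩
    ℤ.+ m ℤ.* ℤ.+ d                                       ≡⟨ ℤ.pos-* m d ⟨
    ℤ.+ (m * d)                                           ∎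
    where open ℤ.≤-Reasoning

fracPow-mono-≤ : ∀ {n m} e → n ≤ m → fracPow n 2 e ≤ℚ fracPow m 2 e
fracPow-mono-≤ e = /-mono-≤ (2 ^ e) {{ℕ.m^n≢0 2 e}}

fracPow-cancel-≤ : ∀ {n m} e → fracPow n 2 e ≤ℚ fracPow m 2 e → n ≤ m
fracPow-cancel-≤ e = /-cancel-≤ (2 ^ e) {{ℕ.m^n≢0 2 e}}

-- Exponential versus linear growth

bernoulli : ∀ b m → b ^ m * (b + m) ≤ b * suc b ^ m
bernoulli b zero = ℕ.≤-reflexive (trans (ℕ.+-identityʳ _) (trans (ℕ.+-identityʳ b) (sym (ℕ.*-identityʳ b))))
bernoulli b (suc m) = begin
  b * p * (b + suc m)                  ≡⟨ regroup b m p ⟩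
  p * (b * (b + m + 1))                ≤⟨ ℕ.m≤m+n _ (p * m) ⟩
  p * (b * (b + m + 1)) + p * m        ≡⟨ factor b m p ⟩
  suc b * (p * (b + m))                ≤⟨ ℕ.*-monoʳ-≤ (suc b) (bernoulli b m) ⟩
  suc b * (b * suc b ^ m)              ≡⟨ ℕ.*-assoc (suc b) b _ ⟨
  suc b * b * suc b ^ m                ≡⟨ cong (_* suc b ^ m) (ℕ.*-comm (suc b) b) ⟩
  b * suc b * suc b ^ m                ≡⟨ ℕ.*-assoc b (suc b) _ ⟩
  b * suc b ^ suc m                    ∎
  where
  open ℕ.≤-Reasoning
  p = b ^ m
  regroup : ∀ b m p → b * p * (b + suc m) ≡ p * (b * (b + m + 1))
  regroup = solve-∀
  factor : ∀ b m p → p * (b * (b + m + 1)) + p * m ≡ suc b * (p * (b + m))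
  factor = solve-∀

-- With M = 2b² + 1, squaring Bernoulli's inequality at M gives the claim at 2M.
linear*pow≤pow-base : ∀ b → 1 ≤ b → let M = 2 * (b * b) + 1 in
  (M + M + 2) * b ^ (M + M) ≤ suc b ^ (M + M)
linear*pow≤pow-base b@(suc _) _ = ℕ.*-cancelʳ-≤ _ _ (b * b) $ begin
  (M + M + 2) * b ^ (M + M) * (b * b)      ≡⟨ cong (λ z → (M + M + 2) * z * (b * b)) (ℕ.^-distribˡ-+-* b M M) ⟩
  (M + M + 2) * (p * p) * (b * b)          ≡⟨ swap (M + M + 2) p b ⟩
  ((M + M + 2) * (b * b)) * (p * p)        ≤⟨ ℕ.*-monoˡ-≤ (p * p) poly ⟩
  ((b + M) * (b + M)) * (p * p)            ≡⟨ square (b + M) p ⟩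
  (p * (b + M)) * (p * (b + M))            ≤⟨ ℕ.*-mono-≤ (bernoulli b M) (bernoulli b M) ⟩
  (b * q) * (b * q)                        ≡⟨ square′ b q ⟩
  (q * q) * (b * b)                        ≡⟨ cong (_* (b * b)) (ℕ.^-distribˡ-+-* (suc b) M M) ⟨
  suc b ^ (M + M) * (b * b)                ∎
  where
  open ℕ.≤-Reasoning
  M = 2 * (b * b) + 1
  p = b ^ M
  q = suc b ^ M
  poly : (M + M + 2) * (b * b) ≤ (b + M) * (b + M)
  poly = ℕ.≤-trans (ℕ.m≤m+n _ (4 * (b * b * b) + b * b + 2 * b + 1)) (ℕ.≤-reflexive (expand b))
    where
    expand : ∀ b → (2 * (b * b) + 1 + (2 * (b * b) + 1) + 2) * (b * b) + (4 * (b * b * b) + b * b + 2 * b + 1)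
                 ≡ (b + (2 * (b * b) + 1)) * (b + (2 * (b * b) + 1))
    expand = solve-∀
  swap : ∀ c p b → c * (p * p) * (b * b) ≡ (c * (b * b)) * (p * p)
  swap = solve-∀
  square : ∀ x p → (x * x) * (p * p) ≡ (p * x) * (p * x)
  square = solve-∀
  square′ : ∀ b q → (b * q) * (b * q) ≡ (q * q) * (b * b)
  square′ = solve-∀

linear*pow≤pow-step : ∀ b n → b ≤ n + 2 → (n + 2) * b ^ n ≤ suc b ^ n → (suc n + 2) * b ^ suc n ≤ suc b ^ suc n
linear*pow≤pow-step b n b≤n+2 ih = begin
  (suc n + 2) * (b * b ^ n)                 ≡⟨ expand n b (b ^ n) ⟩
  ((n + 2) * b + b) * b ^ n                 ≤⟨ ℕ.*-monoˡ-≤ (b ^ n) (ℕ.+-monoʳ-≤ ((n + 2) * b) b≤n+2) ⟩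
  ((n + 2) * b + (n + 2)) * b ^ n           ≡⟨ factor n b (b ^ n) ⟩
  suc b * ((n + 2) * b ^ n)                 ≤⟨ ℕ.*-monoʳ-≤ (suc b) ih ⟩
  suc b * suc b ^ n                         ∎
  where
  open ℕ.≤-Reasoning
  expand : ∀ n b p → (suc n + 2) * (b * p) ≡ ((n + 2) * b + b) * p
  expand = solve-∀
  factor : ∀ n b p → ((n + 2) * b + (n + 2)) * p ≡ suc b * ((n + 2) * p)
  factor = solve-∀

linear*pow≤pow : ∀ b → 1 ≤ b → ∃[ N ] (∀ n → N ≤ n → (n + 2) * b ^ n ≤ suc b ^ n)
linear*pow≤pow b 1≤b = N , λ n N≤n → subst P (ℕ.m+[n∸m]≡n N≤n) (from-N (n ∸ N))
  where
  M = 2 * (b * b) + 1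
  N = M + M
  P : ℕ → Set
  P n = (n + 2) * b ^ n ≤ suc b ^ n
  b≤N : b ≤ N
  b≤N = ℕ.≤-trans (ℕ.m≤n*m b b {{>-nonZero 1≤b}}) (ℕ.≤-trans (ℕ.m≤m+n (b * b) (b * b + 0))
          (ℕ.≤-trans (ℕ.m≤m+n _ 1) (ℕ.m≤m+n M M)))
  from-N : ∀ k → P (N + k)
  from-N zero = subst P (sym (ℕ.+-identityʳ N)) (linear*pow≤pow-base b 1≤b)
  from-N (suc k) = subst P (sym (ℕ.+-suc N k))
    (linear*pow≤pow-step b (N + k) (ℕ.≤-trans b≤N (ℕ.≤-trans (ℕ.m≤m+n N k) (ℕ.m≤m+n _ 2))) (from-N k))

-- Growth rates

linear-eventuallyBelow : ∀ (c : ℕ → ℕ) → (∀ n → c n ≤ suc n) → ∀ a b → 0 < b → b < a → EventuallyBelow c a b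
linear-eventuallyBelow c c≤1+n a b 0<b b<a with linear*pow≤pow b 0<b
... | N , bound = N , λ n N≤n → begin
  c n * b ^ n          ≤⟨ ℕ.*-monoˡ-≤ (b ^ n) (ℕ.≤-trans (c≤1+n n) (ℕ.≤-trans (ℕ.n≤1+n _) (ℕ.≤-reflexive (ℕ.+-comm 2 n)))) ⟩
  (n + 2) * b ^ n      ≤⟨ bound n N≤n ⟩
  suc b ^ n            ≤⟨ ℕ.^-monoˡ-≤ n b<a ⟩
  a ^ n                ∎
  where open ℕ.≤-Reasoning

growthOne : ∀ (c : ℕ → ℕ) → (∀ n → c n ≤ suc n) → (∀ n → 1 ≤ c n) → GrowthOne c
growthOne c c≤1+n 1≤c = linear-eventuallyBelow c c≤1+n , λ a b _ a<b N → N , ℕ.≤-refl , (begin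
  a ^ N          ≤⟨ ℕ.^-monoˡ-≤ N (ℕ.<⇒≤ a<b) ⟩
  b ^ N          ≡⟨ ℕ.*-identityˡ (b ^ N) ⟨
  1 * b ^ N      ≤⟨ ℕ.*-monoˡ-≤ (b ^ N) (1≤c N) ⟩
  c N * b ^ N    ∎)
  where open ℕ.≤-Reasoning

linear-¬GrowthGt : ∀ (c₁ c₂ : ℕ → ℕ) → (∀ n → c₁ n ≤ suc n) → (∀ N → ∃[ n ] (N ≤ n × 1 ≤ c₂ n)) → ¬ GrowthGt c₁ c₂
linear-¬GrowthGt c₁ c₂ c₁≤1+n c₂-pos (a , b , c , d , 0<b , 0<d , ad<cb , (N₁ , below) , above) =
  let (m , N≤m , cᵐ≤) = above N in ℕ.<-irrefl refl (cᵐ<cᵐ m N≤m cᵐ≤)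
  where
  b≤a : b ≤ a
  b≤a with c₂-pos (suc N₁)
  ... | n@(suc _) , N₁<n , 1≤c₂n = ℕ.≮⇒≥ λ a<b → ℕ.<⇒≱ (ℕ.^-monoˡ-< n a<b) $ begin
    b ^ n            ≡⟨ ℕ.*-identityˡ (b ^ n) ⟨
    1 * b ^ n        ≤⟨ ℕ.*-monoˡ-≤ (b ^ n) 1≤c₂n ⟩
    c₂ n * b ^ n     ≤⟨ below n (ℕ.<⇒≤ N₁<n) ⟩
    a ^ n            ∎
    where open ℕ.≤-Reasoning
  d<c : d < c
  d<c = ℕ.*-cancelʳ-< b d c (ℕ.≤-<-trans (ℕ.≤-reflexive (ℕ.*-comm d b)) (ℕ.≤-<-trans (ℕ.*-monoˡ-≤ d b≤a) ad<cb))
  N = proj₁ (linear*pow≤pow d 0<d)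
  cᵐ<cᵐ : ∀ m → N ≤ m → c ^ m ≤ c₁ m * d ^ m → c ^ m < c ^ m
  cᵐ<cᵐ m N≤m cᵐ≤ = begin-strict
    c ^ m              ≤⟨ cᵐ≤ ⟩
    c₁ m * d ^ m       ≤⟨ ℕ.*-monoˡ-≤ (d ^ m) (c₁≤1+n m) ⟩
    suc m * d ^ m      <⟨ ℕ.*-monoˡ-< (d ^ m) {{ℕ.m^n≢0 d m {{>-nonZero 0<d}}}} (ℕ.≤-reflexive (ℕ.+-comm 2 m)) ⟩
    (m + 2) * d ^ m    ≤⟨ proj₂ (linear*pow≤pow d 0<d) m N≤m ⟩
    suc d ^ m          ≤⟨ ℕ.^-monoˡ-≤ m d<c ⟩
    c ^ m              ∎
    where open ℕ.≤-Reasoning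

avoidCount-zero : ∀ (ρ : Arrangement 2 2) n → avoidCount ρ 0 n ≡ 2 ^ n
avoidCount-zero ρ n = trans (cong length (List.filter-all _ (All.tabulate {xs = allWords 2 n} λ _ ()))) (length-allWords n)

twoRunsOfLength : Bit → Bit → ℕ → List Word
twoRunsOfLength x y 0 = [] ∷ []
twoRunsOfLength x y (suc n) = runs y 0 x (suc n) [] ∷ map (y ∷_) (twoRunsOfLength x y n)

length-twoRunsOfLength : ∀ x y n → length (twoRunsOfLength x y n) ≡ suc n
length-twoRunsOfLength x y 0 = refl
length-twoRunsOfLength x y (suc n) = cong suc (trans (List.length-map _ (twoRunsOfLength x y n)) (length-twoRunsOfLength x y n))

∈-twoRunsOfLength : ∀ x y a b → runs y a x b [] ∈ twoRunsOfLength x y (a + b)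
∈-twoRunsOfLength x y 0 0 = here refl
∈-twoRunsOfLength x y 0 (suc b) = here refl
∈-twoRunsOfLength x y (suc a) b = there (∈-map⁺ (y ∷_) (∈-twoRunsOfLength x y a b))

xyHead-avoidCount-≤ : ∀ {x y} ρ j n → x ≢ y → avoidCount ((x · y) ∷ ρ) (suc j) n ≤ suc n
xyHead-avoidCount-≤ {x} {y} ρ j n x≢y = subst (avoidCount ((x · y) ∷ ρ) (suc j) n ≤_) (length-twoRunsOfLength x y n) $
  Unique-⊆⇒length≤ (Unique.filter⁺ _ (allWords-unique n)) λ {s} s∈ →
    let (s∈all , avoids) = ∈-filter⁻ (λ s → ¬? (any? (λ t → occurs? t s) (take (suc j) ((x · y) ∷ ρ)))) s∈ in
    run∈ s (∈-allWords⇒length s∈all) (avoids⇒runs x≢y s (avoids ∘ here))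
  where
  run∈ : ∀ s → length s ≡ n → ∃₂ (λ a b → s ≡ runs y a x b []) → s ∈ twoRunsOfLength x y n
  run∈ s len (a , b , refl) = subst (λ m → runs y a x b [] ∈ twoRunsOfLength x y m)
    (trans (cong (a +_) (sym (ℕ.+-identityʳ b))) (trans (sym (length-runs y a x b [])) len)) (∈-twoRunsOfLength x y a b)

replicate-avoids : ∀ {y : Bit} {t : Dimer} n → t ≢ y · y → Avoids (replicate n y) t
replicate-avoids (suc (suc n)) t≢yy (here t≡yy) = t≢yy t≡yy
replicate-avoids (suc (suc n)) t≢yy (there occ) = replicate-avoids (suc n) t≢yy occ

ρ₀-avoidCount-pos : ∀ n → 1 ≤ avoidCount ρ₀ 1 n
ρ₀-avoidCount-pos n = List.filter-some (λ s → ¬? (any? (λ t → occurs? t s) (take 1 ρ₀)))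
  (lose (subst (λ m → replicate n 𝟏 ∈ allWords 2 m) (List.length-replicate n) (∈-allWords (replicate n 𝟏)))
        λ { (here occ) → replicate-avoids n (λ ()) occ })

xyHead-alphaDrops : ∀ {x y} ρ → x ≢ y → AlphaDrops ((x · y) ∷ ρ) 1
xyHead-alphaDrops {x} {y} ρ x≢y = 3 , 2 , 2 , 1 , s≤s z≤n , s≤s z≤n , ℕ.≤-refl ,
  linear-eventuallyBelow (avoidCount ((x · y) ∷ ρ) 1) (λ n → xyHead-avoidCount-≤ ρ 0 n x≢y) 3 2 (s≤s z≤n) ℕ.≤-refl ,
  λ N → N , ℕ.≤-refl , ℕ.≤-reflexive (sym (trans (cong₂ _*_ (avoidCount-zero ((x · y) ∷ ρ) N) (ℕ.^-zeroˡ N)) (ℕ.*-identityʳ _)))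

infinitelyOftenPositive : ∀ {c} → InfOftenAbove c 1 2 → ∀ N → ∃[ n ] (N ≤ n × 1 ≤ c n)
infinitelyOftenPositive {c} above N =
  let (n , N≤n , 1ⁿ≤) = above N in n , N≤n , positive-factor (c n) (ℕ.≤-trans (ℕ.≤-reflexive (sym (ℕ.^-zeroˡ n))) 1ⁿ≤)
  where
  positive-factor : ∀ m {k} → 1 ≤ m * k → 1 ≤ m
  positive-factor (suc m) _ = s≤s z≤n

xyHead-isHead : ∀ {x y} ρ {π} → x ≢ y → IsHead ((x · y) ∷ ρ) π → π ≡ (x · y) ∷ []
xyHead-isHead ρ x≢y (1 , _ , _ , _ , _ , π≡) = π≡
xyHead-isHead {x} {y} ρ x≢y (suc (suc j) , _ , _ , drops , (_ , above) , _) =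
  ⊥-elim (linear-¬GrowthGt (avoidCount ρ′ (suc j)) (avoidCount ρ′ (2 + j)) (λ n → xyHead-avoidCount-≤ ρ j n x≢y)
            (infinitelyOftenPositive (above 1 2 (s≤s z≤n) ℕ.≤-refl)) drops)
  where ρ′ = (x · y) ∷ ρ

ρ₀-optimal : ∀ w → 2 ≤ w → Optimal ρ₀ w
ρ₀-optimal w 2≤w = ρ₀-InU , linearOrder-UHS ρ₀-linear w (ℕ.≤-trans (s≤s z≤n) 2≤w) , λ τ τ-linear →
  subst (_≤ℚ density τ w) (cong (λ n → fracPow n 2 (w + 2)) (sym (ρ₀-chargedCount w 2≤w)))
        (fracPow-mono-≤ (w + 2) (linearOrder-chargedCount-≥ τ τ-linear w 2≤w))

optimal⇒chargedCount-≤ : ∀ ρ w → 2 ≤ w → Optimal ρ w → chargedCount ρ w ≤ 2 ^ w + w + 5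
optimal⇒chargedCount-≤ ρ w 2≤w (_ , _ , ρ≤) = fracPow-cancel-≤ (w + 2)
  (subst (density ρ w ≤ℚ_) (cong (λ n → fracPow n 2 (w + 2)) (ρ₀-chargedCount w 2≤w)) (ρ≤ ρ₀ ρ₀-linear))

ρ₀-eventuallyOptimal : EventuallyOptimal ρ₀
ρ₀-eventuallyOptimal = ρ₀-InU , λ N → N + 2 , ℕ.m≤m+n N 2 , ρ₀-optimal (N + 2) (ℕ.m≤n+m 2 N)

ρ₀-head : IsHead ρ₀ ((𝟎 · 𝟏) ∷ [])
ρ₀-head = 1 , ℕ.≤-refl , s≤s z≤n , xyHead-alphaDrops ρ₀-tail (λ ()) ,
  growthOne (avoidCount ρ₀ 1) (λ n → xyHead-avoidCount-≤ ρ₀-tail 0 n (λ ())) ρ₀-avoidCount-pos , refl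
  where ρ₀-tail = 𝟏 · 𝟎 ∷ 𝟎 · 𝟎 ∷ 𝟏 · 𝟏 ∷ []

goodHead-01 : GoodHead ((𝟎 · 𝟏) ∷ [])
goodHead-01 1 _ _ = xyHead-alphaDrops [] (λ ())
goodHead-01 (suc (suc _)) _ (s≤s ())

xxHead-¬eventuallyOptimal : ∀ x ρ → ¬ EventuallyOptimal ((x · x) ∷ ρ)
xxHead-¬eventuallyOptimal x ρ (_ , optimal) =
  let (w , 6≤w , ρ-optimal) = optimal 6 in
  ℕ.<⇒≱ (xxHead-bound<chargedCount x ρ w 6≤w) (optimal⇒chargedCount-≤ _ w (ℕ.≤-trans (s≤s (s≤s z≤n)) 6≤w) ρ-optimal)

eventuallyOptimal-head : ∀ (ρ π : Arrangement 2 2) → EventuallyOptimal ρ → IsHead ρ π → ∃[ h ] (π ≡ rename h ((𝟎 · 𝟏) ∷ []))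
eventuallyOptimal-head ((𝟎 · 𝟎) ∷ ρ) π optimal _ = ⊥-elim (xxHead-¬eventuallyOptimal 𝟎 ρ optimal)
eventuallyOptimal-head ((𝟏 · 𝟏) ∷ ρ) π optimal _ = ⊥-elim (xxHead-¬eventuallyOptimal 𝟏 ρ optimal)
eventuallyOptimal-head ((𝟎 · 𝟏) ∷ ρ) π _ head = Perm.id , xyHead-isHead ρ (λ ()) head
eventuallyOptimal-head ((𝟏 · 𝟎) ∷ ρ) π _ head = Perm.transpose 𝟎 𝟏 , xyHead-isHead ρ (λ ()) head
eventuallyOptimal-head [] π _ (_ , 1≤i , i≤0 , _) = ⊥-elim (ℕ.<⇒≱ 1≤i i≤0)

ρ₀-essentiallyUnique : EssentiallyUnique ρ₀
ρ₀-essentiallyUnique = ρ₀-eventuallyOptimal , (𝟎 · 𝟏) ∷ [] , ρ₀-head , goodHead-01 ,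
  λ ρ π optimal head _ → eventuallyOptimal-head ρ π optimal head

theorem11 :
    (∀ (w : ℕ) → 2 ≤ w →
       (∃[ τ ] (IsLinearOrder {2} {2} τ
                × density τ w ≡ fracPow (2 ^ w + w + 5) 2 (w + 2)))
       × (∀ (τ : Arrangement 2 2) → IsLinearOrder τ →
            fracPow (2 ^ w + w + 5) 2 (w + 2) Data.Rational.≤ density τ w))
    × ((∀ (w : ℕ) → 2 ≤ w →
          Optimal {2} {2} ((zero ∷ suc zero ∷ []) ∷ (suc zero ∷ zero ∷ []) ∷ (zero ∷ zero ∷ []) ∷ (suc zero ∷ suc zero ∷ []) ∷ []) w)
       × EssentiallyUnique {2} {2} ((zero ∷ suc zero ∷ []) ∷ (suc zero ∷ zero ∷ []) ∷ (zero ∷ zero ∷ []) ∷ (suc zero ∷ suc zero ∷ []) ∷ []))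
theorem11 =
  (λ w 2≤w → (ρ₀ , ρ₀-linear , cong (λ n → fracPow n 2 (w + 2)) (ρ₀-chargedCount w 2≤w)) ,
             (λ τ τ-linear → fracPow-mono-≤ (w + 2) (linearOrder-chargedCount-≥ τ τ-linear w 2≤w))) ,
  ρ₀-optimal , ρ₀-essentiallyUnique
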